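{- Let $A$ and $B$ be arch systems with $A \sim B$. Then $\mathrm{Av}(A)$ and $\mathrm{Av}(B)$ are Wilf-equivalent, i.e. for every $n \ge 0$ the number of arch systems with $n$ arches avoiding $A$ equals the number of arch systems with $n$ arches avoiding $B$.
   Context: An arch system of size $n$ is a set of $n$ arches drawn above a horizontal baseline, connecting $2n$ points on the baseline so that every point is an endpoint of exactly one arch and no two arches cross (equivalently, a well-parenthesized word with $n$ pairs of parentheses; only the combinatorial configuration matters). The empty arch system has size $0$. An arch system $B$ is contained in (is a subsystem of) $A$ if $B$ can be obtained from $A$ by deleting some arches; otherwise $A$ avoids $B$. $\mathrm{Av}(A)$ denotes the set of arch systems avoiding $A$. The concatenation $AB$ is obtained by drawing $B$ to the right of $A$ on the same baseline. An atom is a non-empty arch system that is not a concatenation of two non-empty arch systems; every atom has the form $\langle A\rangle$, obtained from an arch system $A$ (its contents) by adding one arch enclosing all of $A$. The relation $\sim$ is the finest equivalence relation on arch systems such that, for all arch systems $A,B,P,Q$ and all $a,b,c$ each of which is an atom or the empty arch system: (R1) $A\sim B \Rightarrow \langle A\rangle \sim \langle B\rangle$; (R2) $a \sim b \Rightarrow PaQ \sim PbQ$; (R3) $PabQ \sim PbaQ$; (R4) $a\langle bc\rangle \sim \langle ab\rangle c$. -}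

module Defs where

open import Data.Nat using (ℕ; zero; suc; _+_)
open import Relation.Binary.PropositionalEquality using (_≡_)
open import Relation.Binary.Construct.Closure.ReflexiveTransitive using (Star)
open import Relation.Nullary using (¬_)

-- An arch system is a (possibly empty) sequence of atoms; an atom ⟨ C ⟩ is
-- one arch enclosing the arch system C.  `⟨ C ⟩∷ R` is the atom ⟨ C ⟩
-- followed (to the right) by the arch system R.  (Equivalently, a
-- well-parenthesized word: ⟨ C ⟩∷ R  =  ( C ) R.)
data Arch : Set where
  ε    : Arch
  ⟨_⟩∷_ : Arch → Arch → Arch

⟨_⟩ : Arch → Arch
⟨ C ⟩ = ⟨ C ⟩∷ ε

infixr 5 _++_
_++_ : Arch → Arch → Arch
ε ++ B = B
(⟨ C ⟩∷ R) ++ B = ⟨ C ⟩∷ (R ++ B)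

size : Arch → ℕ
size ε = 0
size (⟨ C ⟩∷ R) = suc (size C + size R)

data Del : Arch → Arch → Set where
  here  : ∀ {C R}    → Del (⟨ C ⟩∷ R) (C ++ R)
  under : ∀ {C C' R} → Del C C' → Del (⟨ C ⟩∷ R) (⟨ C' ⟩∷ R)
  right : ∀ {C R R'} → Del R R' → Del (⟨ C ⟩∷ R) (⟨ C ⟩∷ R')

_⊑_ : Arch → Arch → Set
B ⊑ A = Star Del A B

Avoids : Arch → Arch → Set
Avoids A B = ¬ (B ⊑ A)

data AtomOrEmpty : Arch → Set where
  empty : AtomOrEmpty ε
  atom  : ∀ C → AtomOrEmpty ⟨ C ⟩

infix 4 _∼_
data _∼_ : Arch → Arch → Set where
  ∼-refl  : ∀ {A} → A ∼ A
  ∼-sym   : ∀ {A B} → A ∼ B → B ∼ A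
  ∼-trans : ∀ {A B C} → A ∼ B → B ∼ C → A ∼ C
  R1 : ∀ {A B} → A ∼ B → ⟨ A ⟩ ∼ ⟨ B ⟩
  R2 : ∀ {a b} P Q → AtomOrEmpty a → AtomOrEmpty b → a ∼ b →
       P ++ a ++ Q ∼ P ++ b ++ Q
  R3 : ∀ {a b} P Q → AtomOrEmpty a → AtomOrEmpty b →
       P ++ a ++ b ++ Q ∼ P ++ b ++ a ++ Q
  R4 : ∀ {a b c} → AtomOrEmpty a → AtomOrEmpty b → AtomOrEmpty c →
       a ++ ⟨ b ++ c ⟩ ∼ ⟨ a ++ b ⟩ ++ c

-- The finite set { C ∈ Av(A) | size C = n }.  The avoidance proof (and the
-- size proof) are irrelevant, so elements are determined by the arch system.
record AvOfSize (A : Arch) (n : ℕ) : Set where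
  constructor av
  field
    sys      : Arch
    .hasSize : size sys ≡ n
    .avoids  : Avoids sys A

module Submission where

-- The relation ∼ is generated by moves each of which preserves the generating function of
-- Av(·). For R1, for R3 without context and for R4 this is algebra in ℤ[[x]]: writing an arch
-- system as ⟨ C ⟩ R gives functional equations for the series of ⟨ X ⟩ and ⟨ X ⟩ Y that determine
-- both sides of each move. Moves inside a context P _ Q need a stronger invariant: a bijection on
-- all parenthesis words, preserving length and the unmatched parentheses, that exchanges
-- containment of the two patterns. It extends to P G Q by leaving alone the shortest prefix that
-- contains P and the longest suffix that contains Q, and on balanced words it gives the
-- equality of counts. For ⟨ A ⟩ against ⟨ B ⟩ it applies a size-preserving bijection between
-- arch systems inside every top-level atom, and for ⟨ A ⟩ ⟨ B ⟩ against ⟨ B ⟩ ⟨ A ⟩ it also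
-- reverses the sequence of top-level atoms.

open import Defs
open import Algebra.Bundles using (CommutativeRing)
open import Algebra.Structures using (IsCommutativeRing)
import Algebra.Solver.Ring.AlmostCommutativeRing as ACR
open import Data.Bool using (Bool; true; false)
import Data.Bool as Bool
open import Data.Empty using (⊥; ⊥-elim)
open import Data.Fin using (Fin; zero; suc; cast)
open import Data.Fin.Properties using (cast-trans; cast-is-id)
import Data.Integer as ℤ
open import Data.Integer using (ℤ; -_; 0ℤ; 1ℤ) renaming (_+_ to _+ℤ_; _*_ to _*ℤ_)
open import Data.Integer.Base using (+-*-rawRing)
import Data.Integer.Properties as ℤₚ
open import Data.Integer.Tactic.RingSolver using () renaming (solve-∀ to solve-∀ℤ)
open import Data.List using (List; []; _∷_; length; map; filter; cartesianProduct; lookup; take; drop; reverse) renaming (_++_ to _++L_)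
open import Data.List.Properties
  using (take-all; length-++; length-map; take++drop≡id; drop-drop; take-take; length-take; map-++; reverse-++;
         reverse-involutive; length-reverse; unfold-reverse)
  renaming (++-assoc to ++L-assoc; ++-identityʳ to ++L-identityʳ)
open import Data.List.Membership.Propositional using (_∈_)
open import Data.List.Membership.Propositional.Properties
  using (∈-map⁺; ∈-map⁻; ∈-++⁺ˡ; ∈-++⁺ʳ; ∈-++⁻; ∈-cartesianProduct⁺; ∈-cartesianProduct⁻; ∈-filter⁺; ∈-filter⁻; ∈-∃++; ∈-lookup)
open import Data.List.Relation.Unary.All using ([]; _∷_)
import Data.List.Relation.Unary.All as All
open import Data.List.Relation.Unary.AllPairs using ([]; _∷_)
open import Data.List.Relation.Unary.Any using (Any; here; there; index)
import Data.List.Relation.Unary.Any as Any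
import Data.List.Relation.Unary.Any.Properties as AnyP
open import Data.List.Relation.Unary.Unique.Propositional using (Unique)
import Data.List.Relation.Unary.Unique.Propositional.Properties as UP
open import Data.Maybe using (just; nothing)
open import Data.Nat using (ℕ; zero; suc; _+_; _*_; _≤_; _<_; z≤n; s≤s; _∸_; pred)
open import Data.Nat.ListAction using (sum)
import Data.Nat.Properties as ℕₚ
open import Data.Nat.Tactic.RingSolver using () renaming (solve-∀ to solve-∀ℕ)
open import Data.Product using (Σ; _×_; _,_; proj₁; proj₂)
open import Data.Product.Properties using (≡-dec)
open import Data.Sum using (_⊎_; inj₁; inj₂; [_,_]′)
open import Function.Bundles using (_↔_; mk↔ₛ′)
open import Relation.Binary.Construct.Closure.ReflexiveTransitive using (_◅_; _◅◅_) renaming (ε to sε)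
open import Relation.Binary.Definitions using (DecidableEquality; tri<; tri≈; tri>)
open import Relation.Binary.PropositionalEquality
open import Relation.Binary.Structures using (IsEquivalence)
open import Relation.Nullary using (¬_; Dec; yes; no; does; WeaklyDecidable)
open import Relation.Nullary.Decidable using (_×-dec_)
open import Relation.Unary using (Decidable)
open import Relation.Unary.Properties using (_∩?_; ∁?)

-- Concatenation and containment

++-identityʳ : ∀ A → A ++ ε ≡ A
++-identityʳ ε = refl
++-identityʳ (⟨ C ⟩∷ R) = cong (⟨ C ⟩∷_) (++-identityʳ R)

++-assoc : ∀ A B C → (A ++ B) ++ C ≡ A ++ (B ++ C)
++-assoc ε B C = refl
++-assoc (⟨ X ⟩∷ R) B C = cong (⟨ X ⟩∷_) (++-assoc R B C)

size-++ : ∀ A B → size (A ++ B) ≡ size A + size B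
size-++ ε B = refl
size-++ (⟨ C ⟩∷ R) B = cong suc (trans (cong (size C +_) (size-++ R B)) (sym (ℕₚ.+-assoc (size C) (size R) (size B))))

⟨⟩∷-injectiveˡ : ∀ {A B C D} → (⟨ A ⟩∷ B) ≡ (⟨ C ⟩∷ D) → A ≡ C
⟨⟩∷-injectiveˡ refl = refl
⟨⟩∷-injectiveʳ : ∀ {A B C D} → (⟨ A ⟩∷ B) ≡ (⟨ C ⟩∷ D) → B ≡ D
⟨⟩∷-injectiveʳ refl = refl

++-conical : ∀ A B → A ++ B ≡ ε → (A ≡ ε) × (B ≡ ε)
++-conical ε ε refl = refl , refl
++-conical ε (⟨ _ ⟩∷ _) ()
++-conical (⟨ _ ⟩∷ _) B ()

-- A structural description of containment, by recursion on the host; it is equivalent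
-- to _⊑_ (⊑⇒Emb, Emb⇒⊑) but decidable and easy to decompose along concatenation.
data Emb : Arch → Arch → Set where
  enil   : ∀ {F} → Emb ε F
  eroot  : ∀ {G1 G2 C R} → Emb G1 C → Emb G2 R → Emb (⟨ G1 ⟩∷ G2) (⟨ C ⟩∷ R)
  esplit : ∀ {G C R} G1 G2 → G ≡ G1 ++ G2 → Emb G1 C → Emb G2 R → Emb G (⟨ C ⟩∷ R)

emb-refl : ∀ A → Emb A A
emb-refl ε = enil
emb-refl (⟨ C ⟩∷ R) = eroot (emb-refl C) (emb-refl R)

emb-into-ε : ∀ {G} → Emb G ε → G ≡ ε
emb-into-ε enil = refl

emb-++ˡ : ∀ C {G R} → Emb G R → Emb G (C ++ R)
emb-++ˡ ε E = E
emb-++ˡ (⟨ C1 ⟩∷ C2) {G} E = esplit ε G refl enil (emb-++ˡ C2 E)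

emb-++ : ∀ {G1 G2 C R} → Emb G1 C → Emb G2 R → Emb (G1 ++ G2) (C ++ R)
emb-++ {C = ε} enil E2 = E2
emb-++ {C = ⟨ C1 ⟩∷ C2} enil E2 = emb-++ˡ (⟨ C1 ⟩∷ C2) E2
emb-++ (eroot E E') E2 = eroot E (emb-++ E' E2)
emb-++ {G2 = G2} (esplit H1 H2 refl E E') E2 =
  esplit H1 (H2 ++ G2) (++-assoc H1 H2 G2) E (emb-++ E' E2)

emb-++ʳ : ∀ {G C} R → Emb G C → Emb G (C ++ R)
emb-++ʳ {G} R E = subst (λ X → Emb X _) (++-identityʳ G) (emb-++ E (enil {R}))

emb-++⁻ : ∀ C R {G} → Emb G (C ++ R) → Σ Arch λ G1 → Σ Arch λ G2 → (G ≡ G1 ++ G2) × Emb G1 C × Emb G2 R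
emb-++⁻ ε R {G} E = ε , G , refl , enil , E
emb-++⁻ (⟨ C1 ⟩∷ C2) R enil = ε , ε , refl , enil , enil
emb-++⁻ (⟨ C1 ⟩∷ C2) R (eroot {H1} E1 E2) with emb-++⁻ C2 R E2
... | K1 , K2 , eq , F1 , F2 = (⟨ H1 ⟩∷ K1) , K2 , cong (⟨ H1 ⟩∷_) eq , eroot E1 F1 , F2
emb-++⁻ (⟨ C1 ⟩∷ C2) R (esplit H1 H2 refl E1 E2) with emb-++⁻ C2 R E2
... | K1 , K2 , refl , F1 , F2 = (H1 ++ K1) , K2 , sym (++-assoc H1 K1 K2) , esplit H1 K1 refl E1 F1 , F2

emb-del : ∀ {F F' G} → Del F F' → Emb G F' → Emb G F
emb-del (here {C} {R}) E with emb-++⁻ C R E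
... | G1 , G2 , eq , E1 , E2 = esplit G1 G2 eq E1 E2
emb-del (under d) enil = enil
emb-del (under d) (eroot E1 E2) = eroot (emb-del d E1) E2
emb-del (under d) (esplit G1 G2 eq E1 E2) = esplit G1 G2 eq (emb-del d E1) E2
emb-del (right d) enil = enil
emb-del (right d) (eroot E1 E2) = eroot E1 (emb-del d E2)
emb-del (right d) (esplit G1 G2 eq E1 E2) = esplit G1 G2 eq E1 (emb-del d E2)

⊑⇒Emb : ∀ {F G} → G ⊑ F → Emb G F
⊑⇒Emb {F} sε = emb-refl F
⊑⇒Emb (d ◅ s) = emb-del d (⊑⇒Emb s)

⊑-under : ∀ {C C' R} → C' ⊑ C → (⟨ C' ⟩∷ R) ⊑ (⟨ C ⟩∷ R)
⊑-under sε = sε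
⊑-under (d ◅ s) = under d ◅ ⊑-under s

⊑-right : ∀ {C R R'} → R' ⊑ R → (⟨ C ⟩∷ R') ⊑ (⟨ C ⟩∷ R)
⊑-right sε = sε
⊑-right (d ◅ s) = right d ◅ ⊑-right s

del-++ʳ : ∀ {C C'} R → Del C C' → Del (C ++ R) (C' ++ R)
del-++ʳ R (here {C1} {C2}) = subst (Del (⟨ C1 ⟩∷ (C2 ++ R))) (sym (++-assoc C1 C2 R)) here
del-++ʳ R (under d) = under d
del-++ʳ R (right d) = right (del-++ʳ R d)

del-++ˡ : ∀ C {R R'} → Del R R' → Del (C ++ R) (C ++ R')
del-++ˡ ε d = d
del-++ˡ (⟨ C1 ⟩∷ C2) d = right (del-++ˡ C2 d)

⊑-++ʳ : ∀ {C C'} R → C' ⊑ C → (C' ++ R) ⊑ (C ++ R)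
⊑-++ʳ R sε = sε
⊑-++ʳ R (d ◅ s) = del-++ʳ R d ◅ ⊑-++ʳ R s

⊑-++ˡ : ∀ C {R R'} → R' ⊑ R → (C ++ R') ⊑ (C ++ R)
⊑-++ˡ C sε = sε
⊑-++ˡ C (d ◅ s) = del-++ˡ C d ◅ ⊑-++ˡ C s

ε⊑ : ∀ F → ε ⊑ F
ε⊑ ε = sε
ε⊑ (⟨ C ⟩∷ R) = ⊑-under (ε⊑ C) ◅◅ (⊑-right (ε⊑ R) ◅◅ (here ◅ sε))

Emb⇒⊑ : ∀ {G F} → Emb G F → G ⊑ F
Emb⇒⊑ {F = F} enil = ε⊑ F
Emb⇒⊑ (eroot E1 E2) = ⊑-under (Emb⇒⊑ E1) ◅◅ ⊑-right (Emb⇒⊑ E2)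
Emb⇒⊑ {F = ⟨ C ⟩∷ R} (esplit G1 G2 refl E1 E2) = here ◅ (⊑-++ʳ R (Emb⇒⊑ E1) ◅◅ ⊑-++ˡ G1 (Emb⇒⊑ E2))

-- Deletion sequences compose, so transitivity is easiest through _⊑_.
emb-trans : ∀ {A B C} → Emb A B → Emb B C → Emb A C
emb-trans AB BC = ⊑⇒Emb (Emb⇒⊑ BC ◅◅ Emb⇒⊑ AB)

splits? : (G : Arch) (P : Arch → Arch → Set) → (∀ a b → Dec (P a b)) →
           Dec (Σ Arch λ G1 → Σ Arch λ G2 → (G ≡ G1 ++ G2) × P G1 G2)
splits? ε P P? with P? ε ε
... | yes p = yes (ε , ε , refl , p)
... | no np = no λ { (G1 , G2 , eq , p) → np (helper G1 G2 eq p) }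
  where
  helper : ∀ G1 G2 → ε ≡ G1 ++ G2 → P G1 G2 → P ε ε
  helper G1 G2 eq p with ++-conical G1 G2 (sym eq)
  ... | refl , refl = p
splits? (⟨ X ⟩∷ G') P P? with P? ε (⟨ X ⟩∷ G')
... | yes p = yes (ε , ⟨ X ⟩∷ G' , refl , p)
... | no np with splits? G' (λ a b → P (⟨ X ⟩∷ a) b) (λ a b → P? (⟨ X ⟩∷ a) b)
...   | yes (a , b , eq , p) = yes (⟨ X ⟩∷ a , b , cong (⟨ X ⟩∷_) eq , p)
...   | no nq = no λ { (ε , G2 , refl , p) → np p
                     ; ((⟨ Y ⟩∷ G1) , G2 , eq , p) → nq (G1 , G2 , ⟨⟩∷-injectiveʳ eq , subst (λ Z → P (⟨ Z ⟩∷ G1) G2) (sym (⟨⟩∷-injectiveˡ eq)) p) }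

emb? : ∀ G F → Dec (Emb G F)
emb? ε F = yes enil
emb? (⟨ X ⟩∷ G') ε = no λ ()
emb? (⟨ X ⟩∷ G') (⟨ C ⟩∷ R) with emb? X C ×-dec emb? G' R
... | yes (e1 , e2) = yes (eroot e1 e2)
... | no nr with splits? (⟨ X ⟩∷ G') (λ a b → Emb a C × Emb b R) (λ a b → emb? a C ×-dec emb? b R)
...   | yes (G1 , G2 , eq , e1 , e2) = yes (esplit G1 G2 eq e1 e2)
...   | no ns = no λ { (eroot e1 e2) → nr (e1 , e2)
                     ; (esplit G1 G2 eq e1 e2) → ns (G1 , G2 , eq , e1 , e2) }

emb-content : ∀ X Y → Emb X (⟨ X ⟩∷ Y)
emb-content X Y = esplit X ε (sym (++-identityʳ X)) (emb-refl X) enil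

emb-tail : ∀ X Y → Emb Y (⟨ X ⟩∷ Y)
emb-tail X Y = esplit ε Y refl enil (emb-refl Y)

atomOrEmpty-split : ∀ {Y} G1 G2 → AtomOrEmpty Y → Y ≡ G1 ++ G2 → ((G1 ≡ ε) × (G2 ≡ Y)) ⊎ ((G1 ≡ Y) × (G2 ≡ ε))
atomOrEmpty-split ε G2 a eq = inj₁ (refl , sym eq)
atomOrEmpty-split (⟨ Z ⟩∷ G1) G2 empty ()
atomOrEmpty-split (⟨ Z ⟩∷ G1) G2 (atom C) eq with ++-conical G1 G2 (sym (⟨⟩∷-injectiveʳ eq))
... | refl , refl = inj₂ (sym eq , refl)

emb-atom∷⁻ : ∀ X Y C R → AtomOrEmpty Y → Emb (⟨ X ⟩∷ Y) (⟨ C ⟩∷ R) →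
         (Emb X C × Emb Y R) ⊎ (Emb (⟨ X ⟩∷ Y) R ⊎ Emb (⟨ X ⟩∷ Y) C)
emb-atom∷⁻ X Y C R aY (eroot e1 e2) = inj₁ (e1 , e2)
emb-atom∷⁻ X Y C R aY (esplit ε G2 refl e1 e2) = inj₂ (inj₁ e2)
emb-atom∷⁻ X Y C R aY (esplit (⟨ Z ⟩∷ G1) G2 eq e1 e2) with ⟨⟩∷-injectiveˡ eq | atomOrEmpty-split G1 G2 aY (⟨⟩∷-injectiveʳ eq)
... | refl | inj₁ (refl , refl) = inj₁ (emb-trans (emb-content X ε) e1 , e2)
... | refl | inj₂ (refl , refl) = inj₂ (inj₂ e1)

emb-atom∷⁺ : ∀ X Y C R → (Emb X C × Emb Y R) ⊎ (Emb (⟨ X ⟩∷ Y) R ⊎ Emb (⟨ X ⟩∷ Y) C) → Emb (⟨ X ⟩∷ Y) (⟨ C ⟩∷ R)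
emb-atom∷⁺ X Y C R (inj₁ (e1 , e2)) = eroot e1 e2
emb-atom∷⁺ X Y C R (inj₂ (inj₁ e)) = esplit ε (⟨ X ⟩∷ Y) refl enil e
emb-atom∷⁺ X Y C R (inj₂ (inj₂ e)) = esplit (⟨ X ⟩∷ Y) ε (sym (++-identityʳ _)) e enil

emb-atom⁻ : ∀ S C R → Emb (⟨ S ⟩∷ ε) (⟨ C ⟩∷ R) → Emb S C ⊎ Emb (⟨ S ⟩∷ ε) R
emb-atom⁻ S C R e with emb-atom∷⁻ S ε C R empty e
... | inj₁ (e1 , _) = inj₁ e1
... | inj₂ (inj₁ e2) = inj₂ e2
... | inj₂ (inj₂ e3) = inj₁ (emb-trans (emb-content S ε) e3)

emb-atom⁺ : ∀ S C R → Emb S C ⊎ Emb (⟨ S ⟩∷ ε) R → Emb (⟨ S ⟩∷ ε) (⟨ C ⟩∷ R)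
emb-atom⁺ S C R (inj₁ e) = eroot e enil
emb-atom⁺ S C R (inj₂ e) = esplit ε (⟨ S ⟩∷ ε) refl enil e

take-++-length : ∀ {A : Set} (xs ys : List A) k → take (length xs + k) (xs ++L ys) ≡ xs ++L take k ys
take-++-length [] ys k = refl
take-++-length (x ∷ xs) ys k = cong (x ∷_) (take-++-length xs ys k)

drop-++-length : ∀ {A : Set} (xs ys : List A) k → drop (length xs + k) (xs ++L ys) ≡ drop k ys
drop-++-length [] ys k = refl
drop-++-length (x ∷ xs) ys k = drop-++-length xs ys k

take-++-within : ∀ {A : Set} (xs ys : List A) j → j ≤ length xs → take j (xs ++L ys) ≡ take j xs
take-++-within xs ys zero _ = refl
take-++-within (x ∷ xs) ys (suc j) (s≤s p) = cong (x ∷_) (take-++-within xs ys j p)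

drop-++-within : ∀ {A : Set} (xs ys : List A) j → j ≤ length xs → drop j (xs ++L ys) ≡ drop j xs ++L ys
drop-++-within xs ys zero _ = refl
drop-++-within (x ∷ xs) ys (suc j) (s≤s p) = drop-++-within xs ys j p

length-take-≤ : ∀ {A : Set} c (w : List A) → c ≤ length w → length (take c w) ≡ c
length-take-≤ c w p = trans (length-take c w) (ℕₚ.m≤n⇒m⊓n≡m p)

take-length-++ : ∀ {A : Set} (u y : List A) → take (length u) (u ++L y) ≡ u
take-length-++ u y = trans (cong (λ z → take z (u ++L y)) (sym (ℕₚ.+-identityʳ (length u)))) (trans (take-++-length u y 0) (++L-identityʳ u))

drop-length-++ : ∀ {A : Set} (u y : List A) → drop (length u) (u ++L y) ≡ y
drop-length-++ u y = trans (cong (λ z → drop z (u ++L y)) (sym (ℕₚ.+-identityʳ (length u)))) (drop-++-length u y 0)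

drop-++-beyond : ∀ {A : Set} (u d : List A) j → length u ≤ j → drop j (u ++L d) ≡ drop (j ∸ length u) d
drop-++-beyond [] d j p = refl
drop-++-beyond (x ∷ u) d (suc j) (s≤s p) = drop-++-beyond u d j p

length≡0⇒[] : ∀ {A : Set} (xs : List A) → length xs ≡ 0 → xs ≡ []
length≡0⇒[] [] _ = refl

length-drop-+ : ∀ {X : Set} n (ts : List X) k → length ts ≡ n + k → length (drop n ts) ≡ k
length-drop-+ zero ts k e = e
length-drop-+ (suc n) [] k ()
length-drop-+ (suc n) (x ∷ ts) k e = length-drop-+ n ts k (ℕₚ.suc-injective e)

≤-length : ∀ {X : Set} n (ts : List X) k → length ts ≡ n + k → n ≤ length ts
≤-length n ts k e = subst (n ≤_) (sym e) (ℕₚ.m≤m+n n k)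

map≡[] : ∀ {X Y : Set} (h : X → Y) xs → map h xs ≡ [] → xs ≡ []
map≡[] h [] _ = refl

any-map⁺ : ∀ {A B : Set} {P : A → Set} {Q : B → Set} (h : A → B) → (∀ x → P x → Q (h x)) →
           ∀ {xs} → Any P xs → Any Q (map h xs)
any-map⁺ h f a = AnyP.map⁺ (Any.map (λ {x} → f x) a)

count : ∀ {A : Set} {P : A → Set} → Decidable P → List A → ℕ
count P? xs = length (filter P? xs)

count-cong : ∀ {A : Set} {P Q : A → Set} (P? : Decidable P) (Q? : Decidable Q) →
             (∀ x → P x → Q x) → (∀ x → Q x → P x) → ∀ xs → count P? xs ≡ count Q? xs
count-cong P? Q? f g [] = refl
count-cong P? Q? f g (x ∷ xs) with P? x | Q? x
... | yes p | yes q = cong suc (count-cong P? Q? f g xs)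
... | yes p | no nq = ⊥-elim (nq (f x p))
... | no np | yes q = ⊥-elim (np (g x q))
... | no np | no nq = count-cong P? Q? f g xs

count-via : ∀ {X : Set} {P Q R : X → Set} (P? : Decidable P) (Q? : Decidable Q) (R? : Decidable R) →
  (∀ x → P x → R x) → (∀ x → R x → P x) → (∀ x → Q x → R x) → (∀ x → R x → Q x) → ∀ xs → count P? xs ≡ count Q? xs
count-via P? Q? R? a b c d xs = trans (count-cong P? R? a b xs) (sym (count-cong Q? R? c d xs))

count-++ : ∀ {A : Set} {P : A → Set} (P? : Decidable P) xs ys → count P? (xs ++L ys) ≡ count P? xs + count P? ys
count-++ P? [] ys = refl
count-++ P? (x ∷ xs) ys with P? x
... | yes _ = cong suc (count-++ P? xs ys)
... | no _ = count-++ P? xs ys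

count-map : ∀ {A B : Set} {P : B → Set} (P? : Decidable P) (f : A → B) xs → count P? (map f xs) ≡ count (λ x → P? (f x)) xs
count-map P? f [] = refl
count-map P? f (x ∷ xs) with P? (f x)
... | yes _ = cong suc (count-map P? f xs)
... | no _ = count-map P? f xs

count-none : ∀ {A : Set} {P : A → Set} (P? : Decidable P) xs → (∀ x → ¬ P x) → count P? xs ≡ 0
count-none P? [] h = refl
count-none P? (x ∷ xs) h with P? x
... | yes p = ⊥-elim (h x p)
... | no _ = count-none P? xs h

count-split : ∀ {A : Set} {P S : A → Set} (P? : Decidable P) (S? : Decidable S) xs →
              count P? xs ≡ count (P? ∩? S?) xs + count (P? ∩? ∁? S?) xs
count-split P? S? [] = refl
count-split P? S? (x ∷ xs) with P? x | S? x
... | yes p | yes s = cong suc (count-split P? S? xs)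
... | yes p | no ns = trans (cong suc (count-split P? S? xs)) (sym (ℕₚ.+-suc _ _))
... | no np | yes s = count-split P? S? xs
... | no np | no ns = count-split P? S? xs

count-∁ : ∀ {A : Set} {P : A → Set} (P? : Decidable P) xs → count P? xs + count (∁? P?) xs ≡ length xs
count-∁ P? [] = refl
count-∁ P? (x ∷ xs) with P? x
... | yes p = cong suc (count-∁ P? xs)
... | no np = trans (ℕₚ.+-suc _ _) (cong suc (count-∁ P? xs))

both? : ∀ {A B : Set} {P : A → Set} {Q : B → Set} → Decidable P → Decidable Q →
        Decidable (λ (p : A × B) → P (proj₁ p) × Q (proj₂ p))
both? P? Q? p = P? (proj₁ p) ×-dec Q? (proj₂ p)

count-pairs-with-yes : ∀ {A B : Set} {P : A → Set} {Q : B → Set} (P? : Decidable P) (Q? : Decidable Q) x ys → P x →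
                       count (both? P? Q?) (map (x ,_) ys) ≡ count Q? ys
count-pairs-with-yes P? Q? x [] p = refl
count-pairs-with-yes P? Q? x (y ∷ ys) p with P? x | Q? y
... | yes _ | yes _ = cong suc (count-pairs-with-yes P? Q? x ys p)
... | yes _ | no _ = count-pairs-with-yes P? Q? x ys p
... | no np | _ = ⊥-elim (np p)

count-pairs-with-no : ∀ {A B : Set} {P : A → Set} {Q : B → Set} (P? : Decidable P) (Q? : Decidable Q) x ys → ¬ P x →
                      count (both? P? Q?) (map (x ,_) ys) ≡ 0
count-pairs-with-no P? Q? x [] ¬p = refl
count-pairs-with-no P? Q? x (y ∷ ys) ¬p with P? x
... | yes p = ⊥-elim (¬p p)
... | no _ = count-pairs-with-no P? Q? x ys ¬p

count-cartesianProduct : ∀ {A B : Set} {P : A → Set} {Q : B → Set} (P? : Decidable P) (Q? : Decidable Q) xs ys →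
                         count (both? P? Q?) (cartesianProduct xs ys) ≡ count P? xs * count Q? ys
count-cartesianProduct P? Q? [] ys = refl
count-cartesianProduct P? Q? (x ∷ xs) ys with P? x
... | yes p = trans (count-++ (both? P? Q?) (map (x ,_) ys) (cartesianProduct xs ys))
                    (cong₂ _+_ (count-pairs-with-yes P? Q? x ys p) (count-cartesianProduct P? Q? xs ys))
... | no ¬p = trans (count-++ (both? P? Q?) (map (x ,_) ys) (cartesianProduct xs ys))
                    (cong₂ _+_ (count-pairs-with-no P? Q? x ys ¬p) (count-cartesianProduct P? Q? xs ys))

-- cauchy a b m = Σ_{i + j = m} a i * b j
cauchy : (ℕ → ℕ) → (ℕ → ℕ) → ℕ → ℕ
cauchy a b zero = a 0 * b 0
cauchy a b (suc m) = a 0 * b (suc m) + cauchy (λ k → a (suc k)) b m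

cauchy-cong : ∀ a a' b b' m → (∀ i → i ≤ m → a i ≡ a' i) → (∀ j → j ≤ m → b j ≡ b' j) → cauchy a b m ≡ cauchy a' b' m
cauchy-cong a a' b b' zero ha hb = cong₂ _*_ (ha 0 z≤n) (hb 0 z≤n)
cauchy-cong a a' b b' (suc m) ha hb =
  cong₂ _+_ (cong₂ _*_ (ha 0 z≤n) (hb (suc m) ℕₚ.≤-refl))
            (cauchy-cong (λ k → a (suc k)) (λ k → a' (suc k)) b b' m (λ i i≤m → ha (suc i) (s≤s i≤m)) (λ j j≤m → hb j (ℕₚ.m≤n⇒m≤1+n j≤m)))

length-mono-⊆ : ∀ {A : Set} {xs ys : List A} → Unique xs → (∀ {x} → x ∈ xs → x ∈ ys) → length xs ≤ length ys
length-mono-⊆ {xs = []} u sub = z≤n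
length-mono-⊆ {xs = x ∷ xs} {ys} (h ∷ u) sub with ∈-∃++ (sub (here refl))
... | ys1 , ys2 , refl = subst (suc (length xs) ≤_) (sym (trans (length-++ ys1) (ℕₚ.+-suc (length ys1) (length ys2))))
                           (s≤s (subst (length xs ≤_) (length-++ ys1) (length-mono-⊆ u sub')))
  where
  sub' : ∀ {y} → y ∈ xs → y ∈ ys1 ++L ys2
  sub' {y} m with ∈-++⁻ ys1 (sub (there m))
  ... | inj₁ p = ∈-++⁺ˡ p
  ... | inj₂ (here refl) = ⊥-elim (All.lookup h m refl)
  ... | inj₂ (there p) = ∈-++⁺ʳ ys1 p

count-sameElements : ∀ {A : Set} {P : A → Set} (P? : Decidable P) {xs ys : List A} → Unique xs → Unique ys →
                     (∀ {x} → x ∈ xs → x ∈ ys) → (∀ {x} → x ∈ ys → x ∈ xs) → count P? xs ≡ count P? ys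
count-sameElements P? ux uy f g =
  ℕₚ.≤-antisym (length-mono-⊆ (UP.filter⁺ P? ux) (λ m → let (a , b) = ∈-filter⁻ P? m in ∈-filter⁺ P? (f a) b))
               (length-mono-⊆ (UP.filter⁺ P? uy) (λ m → let (a , b) = ∈-filter⁻ P? m in ∈-filter⁺ P? (g a) b))

index-unique : ∀ {A : Set} {x : A} {xs} → Unique xs → (m1 m2 : x ∈ xs) → index m1 ≡ index m2
index-unique u (here refl) (here refl) = refl
index-unique (h ∷ u) (here refl) (there m2) = ⊥-elim (All.lookup h m2 refl)
index-unique (h ∷ u) (there m1) (here refl) = ⊥-elim (All.lookup h m1 refl)
index-unique (h ∷ u) (there m1) (there m2) = cong suc (index-unique u m1 m2)

index-∈-lookup : ∀ {A : Set} {xs : List A} (i : Fin (length xs)) → index (∈-lookup {xs = xs} i) ≡ i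
index-∈-lookup {xs = x ∷ xs} zero = refl
index-∈-lookup {xs = x ∷ xs} (suc i) = cong suc (index-∈-lookup {xs = xs} i)

cast-cast : ∀ {a b} (e : a ≡ b) (e' : b ≡ a) (i : Fin a) → cast e' (cast e i) ≡ i
cast-cast e e' i = trans (cast-trans e e' i) (cast-is-id _ i)

module Transfer {A : Set} (_≟ᴬ_ : DecidableEquality A) where
  open import Data.List.Membership.DecPropositional _≟ᴬ_ using (_∈?_)

  transfer : (xs ys : List A) → length xs ≡ length ys → A → A
  transfer xs ys e x with x ∈? xs
  ... | yes m = lookup ys (cast e (index m))
  ... | no _ = x

  transfer-∈ : ∀ xs ys e {x} → x ∈ xs → transfer xs ys e x ∈ ys
  transfer-∈ xs ys e {x} x∈ with x ∈? xs
  ... | yes m = ∈-lookup (cast e (index m))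
  ... | no x∉ = ⊥-elim (x∉ x∈)

  transfer-inverse : ∀ xs ys e e' → Unique ys → ∀ {x} → x ∈ xs → transfer ys xs e' (transfer xs ys e x) ≡ x
  transfer-inverse xs ys e e' uy {x} x∈ with x ∈? xs
  ... | no x∉ = ⊥-elim (x∉ x∈)
  ... | yes m with lookup ys (cast e (index m)) ∈? ys
  ...   | no y∉ = ⊥-elim (y∉ (∈-lookup _))
  ...   | yes m' = begin
    lookup xs (cast e' (index m'))                      ≡⟨ cong (λ k → lookup xs (cast e' k)) (index-unique uy m' (∈-lookup i)) ⟩
    lookup xs (cast e' (index (∈-lookup {xs = ys} i)))  ≡⟨ cong (λ k → lookup xs (cast e' k)) (index-∈-lookup i) ⟩
    lookup xs (cast e' (cast e (index m)))              ≡⟨ cong (lookup xs) (cast-cast e e' (index m)) ⟩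
    lookup xs (index m)                                 ≡⟨ sym (AnyP.lookup-index m) ⟩
    x                                                   ∎
    where open ≡-Reasoning
          i = cast e (index m)

-- Enumerating arch systems of a given size

_≟_ : (A B : Arch) → Dec (A ≡ B)
ε ≟ ε = yes refl
ε ≟ (⟨ _ ⟩∷ _) = no λ ()
(⟨ _ ⟩∷ _) ≟ ε = no λ ()
(⟨ C ⟩∷ R) ≟ (⟨ C' ⟩∷ R') with C ≟ C' | R ≟ R'
... | yes refl | yes refl = yes refl
... | no n | _ = no λ e → n (⟨⟩∷-injectiveˡ e)
... | yes _ | no n = no λ e → n (⟨⟩∷-injectiveʳ e)

node : Arch × Arch → Arch
node (C , R) = ⟨ C ⟩∷ R

convolve : (ℕ → List Arch) → (ℕ → List Arch) → ℕ → List (Arch × Arch)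
convolve h1 h2 zero = cartesianProduct (h1 0) (h2 0)
convolve h1 h2 (suc m) = cartesianProduct (h1 0) (h2 (suc m)) ++L convolve (λ k → h1 (suc k)) h2 m

-- The first argument is recursion fuel: enumWithFuel n m is complete only for m ≤ n.
enumWithFuel : ℕ → ℕ → List Arch
enumWithFuel zero zero = ε ∷ []
enumWithFuel zero (suc m) = []
enumWithFuel (suc n) zero = ε ∷ []
enumWithFuel (suc n) (suc m) = map node (convolve (enumWithFuel n) (enumWithFuel n) m)

enum : ℕ → List Arch
enum m = enumWithFuel m m

∈-convolve⁺ : ∀ h1 h2 m i j {x y} → i + j ≡ m → x ∈ h1 i → y ∈ h2 j → (x , y) ∈ convolve h1 h2 m
∈-convolve⁺ h1 h2 zero zero zero refl xm ym = ∈-cartesianProduct⁺ xm ym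
∈-convolve⁺ h1 h2 (suc m) zero .(suc m) refl xm ym = ∈-++⁺ˡ (∈-cartesianProduct⁺ xm ym)
∈-convolve⁺ h1 h2 (suc m) (suc i) j eq xm ym =
  ∈-++⁺ʳ _ (∈-convolve⁺ (λ k → h1 (suc k)) h2 m i j (cong pred eq) xm ym)
∈-convolve⁺ h1 h2 zero (suc i) j () xm ym

∈-convolve⁻ : ∀ h1 h2 m {x y} → (x , y) ∈ convolve h1 h2 m →
             Σ ℕ λ i → Σ ℕ λ j → (i + j ≡ m) × x ∈ h1 i × y ∈ h2 j
∈-convolve⁻ h1 h2 zero p with ∈-cartesianProduct⁻ (h1 0) (h2 0) p
... | a , b = 0 , 0 , refl , a , b
∈-convolve⁻ h1 h2 (suc m) p with ∈-++⁻ (cartesianProduct (h1 0) (h2 (suc m))) p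
... | inj₁ q with ∈-cartesianProduct⁻ (h1 0) (h2 (suc m)) q
...   | a , b = 0 , suc m , refl , a , b
∈-convolve⁻ h1 h2 (suc m) p | inj₂ q with ∈-convolve⁻ (λ k → h1 (suc k)) h2 m q
... | i , j , eq , a , b = suc i , j , cong suc eq , a , b

size≡0⇒ε : ∀ C → size C ≡ 0 → C ≡ ε
size≡0⇒ε ε _ = refl
size≡0⇒ε (⟨ _ ⟩∷ _) ()

enumWithFuel-size : ∀ n m {C} → C ∈ enumWithFuel n m → size C ≡ m
enumWithFuel-size zero zero (here refl) = refl
enumWithFuel-size (suc n) zero (here refl) = refl
enumWithFuel-size (suc n) (suc m) {C} mem with ∈-map⁻ node mem
... | (C1 , R) , p , refl with ∈-convolve⁻ (enumWithFuel n) (enumWithFuel n) m p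
...   | i , j , refl , a , b = cong suc (cong₂ _+_ (enumWithFuel-size n i a) (enumWithFuel-size n j b))

enumWithFuel-complete : ∀ n m C → m ≤ n → size C ≡ m → C ∈ enumWithFuel n m
enumWithFuel-complete zero zero C z≤n eq rewrite size≡0⇒ε C eq = here refl
enumWithFuel-complete (suc n) zero C z≤n eq rewrite size≡0⇒ε C eq = here refl
enumWithFuel-complete (suc n) (suc m) (⟨ C1 ⟩∷ R) (s≤s m≤n) eq =
  ∈-map⁺ node (∈-convolve⁺ (enumWithFuel n) (enumWithFuel n) m (size C1) (size R) eq' (enumWithFuel-complete n (size C1) C1 (ℕₚ.≤-trans (subst (size C1 ≤_) eq' (ℕₚ.m≤m+n _ _)) m≤n) refl)
                                                                 (enumWithFuel-complete n (size R) R (ℕₚ.≤-trans (subst (size R ≤_) eq' (ℕₚ.m≤n+m _ _)) m≤n) refl))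
  where
  eq' : size C1 + size R ≡ m
  eq' = cong pred eq

enum-complete : ∀ C → C ∈ enum (size C)
enum-complete C = enumWithFuel-complete (size C) (size C) C ℕₚ.≤-refl refl

enum-size : ∀ m {C} → C ∈ enum m → size C ≡ m
enum-size m = enumWithFuel-size m m

convolve-unique : ∀ h1 h2 m (sz : Arch → ℕ) → (∀ k x → x ∈ h1 k → sz x ≡ k) → (∀ k → Unique (h1 k)) → (∀ k → Unique (h2 k)) →
               Unique (convolve h1 h2 m)
convolve-unique h1 h2 zero sz h1-sized u1 u2 = UP.cartesianProduct⁺ (u1 0) (u2 0)
convolve-unique h1 h2 (suc m) sz h1-sized u1 u2 =
  UP.++⁺ (UP.cartesianProduct⁺ (u1 0) (u2 (suc m)))
         (convolve-unique (λ k → h1 (suc k)) h2 m (λ x → pred (sz x)) (λ k x p → cong pred (h1-sized (suc k) x p)) (λ k → u1 (suc k)) u2)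
         disj
  where
  disj : ∀ {v} → ¬ (v ∈ cartesianProduct (h1 0) (h2 (suc m)) × v ∈ convolve (λ k → h1 (suc k)) h2 m)
  disj {x , y} (p , q) with ∈-cartesianProduct⁻ (h1 0) (h2 (suc m)) p | ∈-convolve⁻ (λ k → h1 (suc k)) h2 m q
  ... | a , _ | i , j , _ , b , _ with trans (sym (h1-sized 0 x a)) (h1-sized (suc i) x b)
  ... | ()

node-injective : ∀ {p q} → node p ≡ node q → p ≡ q
node-injective {C , R} {C' , R'} e = cong₂ _,_ (⟨⟩∷-injectiveˡ e) (⟨⟩∷-injectiveʳ e)

enumWithFuel-unique : ∀ n m → Unique (enumWithFuel n m)
enumWithFuel-unique zero zero = [] ∷ []
enumWithFuel-unique zero (suc m) = []
enumWithFuel-unique (suc n) zero = [] ∷ []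
enumWithFuel-unique (suc n) (suc m) = UP.map⁺ node-injective (convolve-unique (enumWithFuel n) (enumWithFuel n) m size (λ k x p → enumWithFuel-size n k p) (enumWithFuel-unique n) (enumWithFuel-unique n))

enum-unique : ∀ m → Unique (enum m)
enum-unique m = enumWithFuel-unique m m

count-convolve : ∀ {P Q : Arch → Set} (P? : Decidable P) (Q? : Decidable Q) h1 h2 m →
  count (both? P? Q?) (convolve h1 h2 m) ≡ cauchy (λ i → count P? (h1 i)) (λ j → count Q? (h2 j)) m
count-convolve P? Q? h1 h2 zero = count-cartesianProduct P? Q? (h1 0) (h2 0)
count-convolve P? Q? h1 h2 (suc m) =
  trans (count-++ (both? P? Q?) (cartesianProduct (h1 0) (h2 (suc m))) (convolve (λ k → h1 (suc k)) h2 m))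
        (cong₂ _+_ (count-cartesianProduct P? Q? (h1 0) (h2 (suc m))) (count-convolve P? Q? (λ k → h1 (suc k)) h2 m))

count-enumWithFuel : ∀ n k → k ≤ n → {P : Arch → Set} (P? : Decidable P) → count P? (enumWithFuel n k) ≡ count P? (enum k)
count-enumWithFuel n k k≤n P? = count-sameElements P? (enumWithFuel-unique n k) (enum-unique k)
  (λ {x} m → subst (λ z → x ∈ enum z) (enumWithFuel-size n k m) (enum-complete x))
  (λ {x} m → enumWithFuel-complete n k x k≤n (enum-size k m))

count-enum-suc : ∀ {P : Arch → Set} (P? : Decidable P) n →
  count P? (enum (suc n)) ≡ count (λ p → P? (node p)) (convolve (enumWithFuel n) (enumWithFuel n) n)
count-enum-suc P? n = count-map P? node (convolve (enumWithFuel n) (enumWithFuel n) n)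

count-convolve-enum : ∀ {P Q : Arch → Set} (P? : Decidable P) (Q? : Decidable Q) n →
  count (both? P? Q?) (convolve (enumWithFuel n) (enumWithFuel n) n) ≡ cauchy (λ i → count P? (enum i)) (λ j → count Q? (enum j)) n
count-convolve-enum P? Q? n = trans (count-convolve P? Q? (enumWithFuel n) (enumWithFuel n) n)
  (cauchy-cong _ _ _ _ n (λ i i≤n → count-enumWithFuel n i i≤n P?) (λ j j≤n → count-enumWithFuel n j j≤n Q?))

module BijectionCount (f g : Arch → Arch) (gf : ∀ C → g (f C) ≡ C) (fg : ∀ C → f (g C) ≡ C)
                (fsize : ∀ C → size (f C) ≡ size C) {P Q : Arch → Set} (P? : Decidable P) (Q? : Decidable Q)
                (resp : ∀ C → P C → Q (f C)) (resp' : ∀ C → Q (f C) → P C) where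
  gsize : ∀ C → size (g C) ≡ size C
  gsize C = trans (sym (fsize (g C))) (cong size (fg C))

  count-preserved : ∀ n → count P? (enum n) ≡ count Q? (enum n)
  count-preserved n = ℕₚ.≤-antisym
    (subst (_≤ count Q? (enum n)) (length-map f (filter P? (enum n)))
      (length-mono-⊆ (UP.map⁺ (λ {x} {y} e → trans (sym (gf x)) (trans (cong g e) (gf y))) (UP.filter⁺ P? (enum-unique n))) sub1))
    (subst (_≤ count P? (enum n)) (length-map g (filter Q? (enum n)))
      (length-mono-⊆ (UP.map⁺ (λ {x} {y} e → trans (sym (fg x)) (trans (cong f e) (fg y))) (UP.filter⁺ Q? (enum-unique n))) sub2))
    where
    sub1 : ∀ {y} → y ∈ map f (filter P? (enum n)) → y ∈ filter Q? (enum n)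
    sub1 m with ∈-map⁻ f m
    ... | x , mx , refl with ∈-filter⁻ P? mx
    ... | a , p = ∈-filter⁺ Q? (subst (λ z → f x ∈ enum z) (trans (fsize x) (enum-size n a)) (enum-complete (f x))) (resp x p)
    sub2 : ∀ {y} → y ∈ map g (filter Q? (enum n)) → y ∈ filter P? (enum n)
    sub2 m with ∈-map⁻ g m
    ... | x , mx , refl with ∈-filter⁻ Q? mx
    ... | a , q = ∈-filter⁺ P? (subst (λ z → g x ∈ enum z) (trans (gsize x) (enum-size n a)) (enum-complete (g x)))
                     (resp' (g x) (subst Q (sym (fg x)) q))

record ClassBijection {K : Set} (κ1 κ2 : Arch → K) : Set where
  field
    f g : Arch → Arch
    gf : ∀ C → g (f C) ≡ C
    fg : ∀ C → f (g C) ≡ C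
    fsize : ∀ C → size (f C) ≡ size C
    fclass : ∀ C → κ2 (f C) ≡ κ1 C

  gsize : ∀ C → size (g C) ≡ size C
  gsize C = trans (sym (fsize (g C))) (cong size (fg C))

  gclass : ∀ C → κ1 (g C) ≡ κ2 C
  gclass C = trans (sym (fclass (g C))) (cong κ2 (fg C))

module ClassBijectionFromCounts {K : Set} (_≟K_ : DecidableEquality K) (κ1 κ2 : Arch → K)
   (hyp : ∀ c n → count (λ C → κ1 C ≟K c) (enum n) ≡ count (λ C → κ2 C ≟K c) (enum n)) where
  open Transfer _≟_

  X Y : ℕ → K → List Arch
  X n c = filter (λ C → κ1 C ≟K c) (enum n)
  Y n c = filter (λ C → κ2 C ≟K c) (enum n)

  f g : Arch → Arch
  f C = transfer (X (size C) (κ1 C)) (Y (size C) (κ1 C)) (hyp (κ1 C) (size C)) C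
  g D = transfer (Y (size D) (κ2 D)) (X (size D) (κ2 D)) (sym (hyp (κ2 D) (size D))) D

  X-self : ∀ C → C ∈ X (size C) (κ1 C)
  X-self C = ∈-filter⁺ _ (enum-complete C) refl
  Y-self : ∀ D → D ∈ Y (size D) (κ2 D)
  Y-self D = ∈-filter⁺ _ (enum-complete D) refl

  f∈Y : ∀ C → f C ∈ Y (size C) (κ1 C)
  f∈Y C = transfer-∈ _ _ _ (X-self C)
  g∈X : ∀ D → g D ∈ X (size D) (κ2 D)
  g∈X D = transfer-∈ _ _ _ (Y-self D)

  f-size : ∀ C → size (f C) ≡ size C
  f-size C = enum-size (size C) (proj₁ (∈-filter⁻ (λ D → κ2 D ≟K κ1 C) {xs = enum (size C)} (f∈Y C)))
  f-class : ∀ C → κ2 (f C) ≡ κ1 C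
  f-class C = proj₂ (∈-filter⁻ (λ D → κ2 D ≟K κ1 C) {xs = enum (size C)} (f∈Y C))
  g-size : ∀ D → size (g D) ≡ size D
  g-size D = enum-size (size D) (proj₁ (∈-filter⁻ (λ C → κ1 C ≟K κ2 D) {xs = enum (size D)} (g∈X D)))
  g-class : ∀ D → κ1 (g D) ≡ κ2 D
  g-class D = proj₂ (∈-filter⁻ (λ C → κ1 C ≟K κ2 D) {xs = enum (size D)} (g∈X D))

  g∘f : ∀ C → g (f C) ≡ C
  g∘f C rewrite f-size C | f-class C = transfer-inverse _ _ _ _ (UP.filter⁺ _ (enum-unique (size C))) (X-self C)
  f∘g : ∀ D → f (g D) ≡ D
  f∘g D rewrite g-size D | g-class D = transfer-inverse _ _ _ _ (UP.filter⁺ _ (enum-unique (size D))) (Y-self D)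

  classBijection : ClassBijection κ1 κ2
  classBijection = record { f = f ; g = g ; gf = g∘f ; fg = f∘g ; fsize = f-size ; fclass = f-class }

-- Formal power series over ℤ

Series : Set
Series = ℕ → ℤ

infix 4 _≈_
_≈_ : Series → Series → Set
f ≈ g = ∀ n → f n ≡ g n

infixl 6 _⊕_
infixl 7 _⊗_
_⊕_ : Series → Series → Series
(f ⊕ g) n = f n +ℤ g n

⊖_ : Series → Series
(⊖ f) n = - (f n)

_⊗_ : Series → Series → Series
(f ⊗ g) zero = f 0 *ℤ g 0
(f ⊗ g) (suc n) = f 0 *ℤ g (suc n) +ℤ ((λ k → f (suc k)) ⊗ g) n

cst : ℤ → Series
cst c zero = c
cst c (suc n) = 0ℤ

𝟘 𝟙 𝕏 : Series
𝟘 = cst 0ℤ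
𝟙 = cst 1ℤ
𝕏 zero = 0ℤ
𝕏 (suc zero) = 1ℤ
𝕏 (suc (suc n)) = 0ℤ

shift : Series → Series
shift f k = f (suc k)

scale : ℤ → Series → Series
scale c f n = c *ℤ f n

≈-refl : ∀ {f} → f ≈ f
≈-refl n = refl
≈-sym : ∀ {f g} → f ≈ g → g ≈ f
≈-sym e n = sym (e n)
≈-trans : ∀ {f g h} → f ≈ g → g ≈ h → f ≈ h
≈-trans e e' n = trans (e n) (e' n)

⊕-cong : ∀ {f f' g g'} → f ≈ f' → g ≈ g' → f ⊕ g ≈ f' ⊕ g'
⊕-cong e e' n = cong₂ _+ℤ_ (e n) (e' n)

⊖-cong : ∀ {f f'} → f ≈ f' → ⊖ f ≈ ⊖ f'
⊖-cong e n = cong -_ (e n)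

⊗-cong : ∀ {f f' g g'} → f ≈ f' → g ≈ g' → f ⊗ g ≈ f' ⊗ g'
⊗-cong ef eg zero = cong₂ _*ℤ_ (ef 0) (eg 0)
⊗-cong ef eg (suc n) = cong₂ _+ℤ_ (cong₂ _*ℤ_ (ef 0) (eg (suc n))) (⊗-cong (λ k → ef (suc k)) eg n)

+ℤ-interchange : ∀ a b c d → (a +ℤ b) +ℤ (c +ℤ d) ≡ (a +ℤ c) +ℤ (b +ℤ d)
+ℤ-interchange = solve-∀ℤ

⊗-distribʳ : ∀ f g h → (f ⊕ g) ⊗ h ≈ f ⊗ h ⊕ g ⊗ h
⊗-distribʳ f g h zero = ℤₚ.*-distribʳ-+ (h 0) (f 0) (g 0)
⊗-distribʳ f g h (suc n) =
  trans (cong₂ _+ℤ_ (ℤₚ.*-distribʳ-+ (h (suc n)) (f 0) (g 0)) (⊗-distribʳ (shift f) (shift g) h n))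
        (+ℤ-interchange (f 0 *ℤ h (suc n)) (g 0 *ℤ h (suc n)) ((shift f ⊗ h) n) ((shift g ⊗ h) n))

⊗-distribˡ : ∀ f g h → f ⊗ (g ⊕ h) ≈ f ⊗ g ⊕ f ⊗ h
⊗-distribˡ f g h zero = ℤₚ.*-distribˡ-+ (f 0) (g 0) (h 0)
⊗-distribˡ f g h (suc n) =
  trans (cong₂ _+ℤ_ (ℤₚ.*-distribˡ-+ (f 0) (g (suc n)) (h (suc n))) (⊗-distribˡ (shift f) g h n))
        (+ℤ-interchange (f 0 *ℤ g (suc n)) (f 0 *ℤ h (suc n)) ((shift f ⊗ g) n) ((shift f ⊗ h) n))

scale-⊗ : ∀ c f g → scale c f ⊗ g ≈ scale c (f ⊗ g)
scale-⊗ c f g zero = ℤₚ.*-assoc c (f 0) (g 0)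
scale-⊗ c f g (suc n) = trans (cong₂ _+ℤ_ (ℤₚ.*-assoc c (f 0) (g (suc n))) (scale-⊗ c (shift f) g n))
  (sym (ℤₚ.*-distribˡ-+ c (f 0 *ℤ g (suc n)) ((shift f ⊗ g) n)))

shift-⊗ : ∀ f g → shift (f ⊗ g) ≈ scale (f 0) (shift g) ⊕ shift f ⊗ g
shift-⊗ f g n = refl

⊗-assoc : ∀ f g h → (f ⊗ g) ⊗ h ≈ f ⊗ (g ⊗ h)
⊗-assoc f g h zero = ℤₚ.*-assoc (f 0) (g 0) (h 0)
⊗-assoc f g h (suc n) =
  trans (cong ((f 0 *ℤ g 0) *ℤ h (suc n) +ℤ_)
          (trans (⊗-cong (shift-⊗ f g) ≈-refl n)
          (trans (⊗-distribʳ (scale (f 0) (shift g)) (shift f ⊗ g) h n)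
                 (cong₂ _+ℤ_ (scale-⊗ (f 0) (shift g) h n) (⊗-assoc (shift f) g h n)))))
  (regroup (f 0) (g 0) (h (suc n)) ((shift g ⊗ h) n) ((shift f ⊗ (g ⊗ h)) n))
  where
  regroup : ∀ a b c d e → (a *ℤ b) *ℤ c +ℤ (a *ℤ d +ℤ e) ≡ a *ℤ (b *ℤ c +ℤ d) +ℤ e
  regroup = solve-∀ℤ

⊗-sucʳ : ∀ f g n → (f ⊗ g) (suc n) ≡ (f ⊗ shift g) n +ℤ f (suc n) *ℤ g 0
⊗-sucʳ f g zero = refl
⊗-sucʳ f g (suc n) = trans (cong (f 0 *ℤ g (suc (suc n)) +ℤ_) (⊗-sucʳ (shift f) g n))
  (sym (ℤₚ.+-assoc (f 0 *ℤ g (suc (suc n))) ((shift f ⊗ shift g) n) (f (suc (suc n)) *ℤ g 0)))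

⊗-comm : ∀ f g → f ⊗ g ≈ g ⊗ f
⊗-comm f g zero = ℤₚ.*-comm (f 0) (g 0)
⊗-comm f g (suc n) = trans (cong₂ _+ℤ_ (ℤₚ.*-comm (f 0) (g (suc n))) (⊗-comm (shift f) g n))
  (trans (ℤₚ.+-comm (g (suc n) *ℤ f 0) ((g ⊗ shift f) n)) (sym (⊗-sucʳ g f n)))

𝟘≈0 : 𝟘 ≈ (λ _ → 0ℤ)
𝟘≈0 zero = refl
𝟘≈0 (suc n) = refl

0⊗ : ∀ f → (λ _ → 0ℤ) ⊗ f ≈ (λ _ → 0ℤ)
0⊗ f zero = refl
0⊗ f (suc n) = trans (ℤₚ.+-identityˡ _) (0⊗ f n)

⊗-zeroˡ : ∀ f → 𝟘 ⊗ f ≈ 𝟘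
⊗-zeroˡ f n = trans (⊗-cong 𝟘≈0 ≈-refl n) (trans (0⊗ f n) (sym (𝟘≈0 n)))

⊗-zeroʳ : ∀ f → f ⊗ 𝟘 ≈ 𝟘
⊗-zeroʳ f n = trans (⊗-comm f 𝟘 n) (⊗-zeroˡ f n)

⊗-identityˡ : ∀ f → 𝟙 ⊗ f ≈ f
⊗-identityˡ f zero = ℤₚ.*-identityˡ (f 0)
⊗-identityˡ f (suc n) = trans (cong₂ _+ℤ_ (ℤₚ.*-identityˡ (f (suc n))) (0⊗ f n)) (ℤₚ.+-identityʳ (f (suc n)))

⊗-identityʳ : ∀ f → f ⊗ 𝟙 ≈ f
⊗-identityʳ f n = trans (⊗-comm f 𝟙 n) (⊗-identityˡ f n)

shift-𝕏 : shift 𝕏 ≈ 𝟙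
shift-𝕏 zero = refl
shift-𝕏 (suc k) = refl

𝕏⊗-suc : ∀ f n → (𝕏 ⊗ f) (suc n) ≡ f n
𝕏⊗-suc f n = trans (ℤₚ.+-identityˡ _) (trans (⊗-cong shift-𝕏 ≈-refl n) (⊗-identityˡ f n))

≈-isEquivalence : IsEquivalence _≈_
≈-isEquivalence = record { refl = ≈-refl ; sym = ≈-sym ; trans = ≈-trans }

series-isCommutativeRing : IsCommutativeRing _≈_ _⊕_ _⊗_ ⊖_ 𝟘 𝟙
series-isCommutativeRing = record
  { isRing = record
    { +-isAbelianGroup = record
      { isGroup = record
        { isMonoid = record
          { isSemigroup = record
            { isMagma = record { isEquivalence = ≈-isEquivalence ; ∙-cong = ⊕-cong }
            ; assoc = λ f g h n → ℤₚ.+-assoc (f n) (g n) (h n) }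
          ; identity = (λ f n → trans (cong (_+ℤ f n) (𝟘≈0 n)) (ℤₚ.+-identityˡ (f n)))
                     , (λ f n → trans (cong (f n +ℤ_) (𝟘≈0 n)) (ℤₚ.+-identityʳ (f n))) }
        ; inverse = (λ f n → trans (ℤₚ.+-inverseˡ (f n)) (sym (𝟘≈0 n)))
                  , (λ f n → trans (ℤₚ.+-inverseʳ (f n)) (sym (𝟘≈0 n)))
        ; ⁻¹-cong = ⊖-cong }
      ; comm = λ f g n → ℤₚ.+-comm (f n) (g n) }
    ; *-cong = ⊗-cong
    ; *-assoc = ⊗-assoc
    ; *-identity = ⊗-identityˡ , ⊗-identityʳ
    ; distrib = ⊗-distribˡ , (λ h f g → ⊗-distribʳ f g h) }
  ; *-comm = ⊗-comm }

seriesRing : CommutativeRing _ _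
seriesRing = record { isCommutativeRing = series-isCommutativeRing }

cst-* : ∀ a b → cst (a *ℤ b) ≈ cst a ⊗ cst b
cst-* a b zero = refl
cst-* a b (suc n) = sym (trans (cong (_+ℤ (shift (cst a) ⊗ cst b) n) (ℤₚ.*-zeroʳ a)) (trans (ℤₚ.+-identityˡ _) (0⊗ (cst b) n)))

cst-homomorphism : +-*-rawRing ACR.-Raw-AlmostCommutative⟶ ACR.fromCommutativeRing seriesRing
cst-homomorphism = record
  { ⟦_⟧ = cst
  ; +-homo = λ a b → λ { zero → refl ; (suc n) → refl }
  ; *-homo = cst-*
  ; -‿homo = λ a → λ { zero → refl ; (suc n) → refl }
  ; 0-homo = λ { zero → refl ; (suc n) → refl }
  ; 1-homo = λ { zero → refl ; (suc n) → refl } }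

cst≟ : ∀ a b → WeaklyDecidable (cst a ≈ cst b)
cst≟ a b with a ℤₚ.≟ b
... | yes refl = just ≈-refl
... | no _ = nothing

open import Algebra.Solver.Ring +-*-rawRing (ACR.fromCommutativeRing seriesRing) cst-homomorphism cst≟

≈⇒difference≈𝟘 : ∀ {a b} → a ≈ b → a ⊕ ⊖ b ≈ 𝟘
≈⇒difference≈𝟘 {a} {b} e n = trans (cong (_+ℤ - b n) (e n)) (trans (ℤₚ.+-inverseʳ (b n)) (sym (𝟘≈0 n)))

difference≈𝟘⇒≈ : ∀ {a b} → a ⊕ ⊖ b ≈ 𝟘 → a ≈ b
difference≈𝟘⇒≈ {a} {b} e n = ℤₚ.i-j≡0⇒i≡j (a n) (b n) (trans (e n) (𝟘≈0 n))

⊕-≈𝟘 : ∀ {a b} → a ≈ 𝟘 → b ≈ 𝟘 → a ⊕ b ≈ 𝟘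
⊕-≈𝟘 e e' n = trans (cong₂ _+ℤ_ (e n) (e' n)) (trans (cong₂ _+ℤ_ (𝟘≈0 n) (𝟘≈0 n)) (sym (𝟘≈0 n)))

⊗-≈𝟘 : ∀ w {z} → z ≈ 𝟘 → w ⊗ z ≈ 𝟘
⊗-≈𝟘 w ez = ≈-trans (⊗-cong ≈-refl ez) (⊗-zeroʳ w)

⊗-vanishes : ∀ z w n → (∀ k → k ≤ n → z k ≡ 0ℤ) → (z ⊗ w) n ≡ 0ℤ
⊗-vanishes z w zero h rewrite h 0 z≤n = refl
⊗-vanishes z w (suc n) h rewrite h 0 z≤n = trans (ℤₚ.+-identityˡ _) (⊗-vanishes (shift z) w n (λ k k≤n → h (suc k) (s≤s k≤n)))

-- A series with constant term 1 is not a zero divisor: the coefficients of z vanish one by one.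
unit⊗≈𝟘 : ∀ u z → u 0 ≡ 1ℤ → u ⊗ z ≈ 𝟘 → z ≈ 𝟘
unit⊗≈𝟘 u z u0 e n = trans (vanish n n ℕₚ.≤-refl) (sym (𝟘≈0 n))
  where
  open ≡-Reasoning
  z·u0 : ∀ k → z k *ℤ u 0 ≡ z k
  z·u0 k = trans (cong (z k *ℤ_) u0) (ℤₚ.*-identityʳ (z k))
  vanish : ∀ m k → k ≤ m → z k ≡ 0ℤ
  vanish m zero _ = begin
    z 0             ≡⟨ sym (z·u0 0) ⟩
    (z ⊗ u) 0       ≡⟨ ⊗-comm z u 0 ⟩
    (u ⊗ z) 0       ≡⟨ e 0 ⟩
    0ℤ              ∎
  vanish (suc m) (suc k) (s≤s k≤m) = begin
    z (suc k)                                   ≡⟨ sym (z·u0 (suc k)) ⟩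
    z (suc k) *ℤ u 0                            ≡⟨ sym (ℤₚ.+-identityˡ _) ⟩
    0ℤ +ℤ z (suc k) *ℤ u 0                      ≡⟨ cong (_+ℤ z (suc k) *ℤ u 0) (sym (⊗-vanishes z (shift u) k earlier)) ⟩
    (z ⊗ shift u) k +ℤ z (suc k) *ℤ u 0         ≡⟨ sym (⊗-sucʳ z u k) ⟩
    (z ⊗ u) (suc k)                             ≡⟨ ⊗-comm z u (suc k) ⟩
    (u ⊗ z) (suc k)                             ≡⟨ e (suc k) ⟩
    0ℤ                                          ∎
    where
    earlier : ∀ j → j ≤ k → z j ≡ 0ℤ
    earlier j j≤k = vanish m j (ℕₚ.≤-trans j≤k k≤m)

⊗-cancelˡ-unit : ∀ u a b → u 0 ≡ 1ℤ → u ⊗ a ≈ u ⊗ b → a ≈ b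
⊗-cancelˡ-unit u a b u0 e = difference≈𝟘⇒≈ (unit⊗≈𝟘 u (a ⊕ ⊖ b) u0
  (≈-trans (solve 3 (λ u a b → u :* (a :- b) := u :* a :- u :* b) ≈-refl u a b) (≈⇒difference≈𝟘 e)))

𝕏⊗≈𝟘 : ∀ z → 𝕏 ⊗ z ≈ 𝟘 → z ≈ 𝟘
𝕏⊗≈𝟘 z e n = trans (sym (𝕏⊗-suc z n)) (trans (e (suc n)) (sym (𝟘≈0 n)))

⟦_⟧ℕ : (ℕ → ℕ) → Series
⟦ a ⟧ℕ n = ℤ.+ a n

⟦cauchy⟧ : ∀ a b n → ℤ.+ (cauchy a b n) ≡ (⟦ a ⟧ℕ ⊗ ⟦ b ⟧ℕ) n
⟦cauchy⟧ a b zero = ℤₚ.pos-* (a 0) (b 0)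
⟦cauchy⟧ a b (suc n) = trans (ℤₚ.pos-+ (a 0 * b (suc n)) _) (cong₂ _+ℤ_ (ℤₚ.pos-* (a 0) (b (suc n))) (⟦cauchy⟧ (λ k → a (suc k)) b n))

-- Generating functions of avoiders

avoids? : (P : Arch) → Decidable (λ C → ¬ Emb P C)
avoids? P = ∁? (emb? P)

avCount : Arch → ℕ → ℕ
avCount P n = count (avoids? P) (enum n)

⟦_⟧A : Arch → Series
⟦ P ⟧A = ⟦ avCount P ⟧ℕ

avCount-ε : ∀ n → avCount ε n ≡ 0
avCount-ε n = count-none (avoids? ε) (enum n) (λ x ne → ne enil)

gf≈⇒avCount≡ : ∀ A B → ⟦ A ⟧A ≈ ⟦ B ⟧A → ∀ n → avCount A n ≡ avCount B n
gf≈⇒avCount≡ A B e n = ℤₚ.+-injective (e n)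

-- ⟨ C ⟩∷ R avoids ⟨ S ⟩ iff C avoids S and R avoids ⟨ S ⟩.
gf-atom : ∀ S → ⟦ ⟨ S ⟩∷ ε ⟧A ≈ 𝟙 ⊕ 𝕏 ⊗ (⟦ S ⟧A ⊗ ⟦ ⟨ S ⟩∷ ε ⟧A)
gf-atom S zero = refl
gf-atom S (suc m) =
  trans (cong ℤ.+_ (trans (count-enum-suc (avoids? P) m)
        (trans (count-cong (λ p → avoids? P (node p)) (both? (avoids? S) (avoids? P))
                  (λ { (C , R) ne → (λ e → ne (emb-atom⁺ S C R (inj₁ e))) , (λ e → ne (emb-atom⁺ S C R (inj₂ e))) })
                  (λ { (C , R) (n1 , n2) e → [ n1 , n2 ]′ (emb-atom⁻ S C R e) })
                  (convolve (enumWithFuel m) (enumWithFuel m) m))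
        (count-convolve-enum (avoids? S) (avoids? P) m))))
  (trans (⟦cauchy⟧ (avCount S) (avCount P) m) (sym (trans (ℤₚ.+-identityˡ _) (𝕏⊗-suc _ m))))
  where
  P = ⟨ S ⟩∷ ε

containsButAvoids : Arch → Arch → ℕ → ℕ
containsButAvoids X P i = count (emb? X ∩? avoids? P) (enum i)

avCount-split : ∀ X Y i → avCount (⟨ X ⟩∷ Y) i ≡ containsButAvoids X (⟨ X ⟩∷ Y) i + avCount X i
avCount-split X Y i = trans (count-split (avoids? P) (emb? X) (enum i))
  (cong₂ _+_ (count-cong _ _ (λ _ (a , b) → b , a) (λ _ (a , b) → b , a) (enum i))
             (count-cong _ (avoids? X) (λ _ (_ , b) → b) (λ _ b → (λ e → b (emb-trans (emb-content X Y) e)) , b) (enum i)))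
  where P = ⟨ X ⟩∷ Y

⟦containsButAvoids⟧ : ∀ X Y → ⟦ containsButAvoids X (⟨ X ⟩∷ Y) ⟧ℕ ≈ ⟦ ⟨ X ⟩∷ Y ⟧A ⊕ ⊖ ⟦ X ⟧A
⟦containsButAvoids⟧ X Y i = sym (begin
  ℤ.+ avCount (⟨ X ⟩∷ Y) i +ℤ - ℤ.+ avCount X i  ≡⟨ cong (λ t → ℤ.+ t +ℤ - ℤ.+ avCount X i) (avCount-split X Y i) ⟩
  ℤ.+ (d + a) +ℤ - ℤ.+ a                        ≡⟨ cong (_+ℤ - ℤ.+ a) (ℤₚ.pos-+ d a) ⟩
  (ℤ.+ d +ℤ ℤ.+ a) +ℤ - ℤ.+ a                   ≡⟨ cancel (ℤ.+ d) (ℤ.+ a) ⟩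
  ℤ.+ d                                         ∎)
  where
  open ≡-Reasoning
  d = containsButAvoids X (⟨ X ⟩∷ Y) i
  a = avCount X i
  cancel : ∀ u v → (u +ℤ v) +ℤ - v ≡ u
  cancel = solve-∀ℤ

-- ⟨ C ⟩∷ R avoids ⟨ X ⟩∷ Y iff either C contains X, C avoids ⟨ X ⟩∷ Y and R avoids Y,
-- or C avoids X and R avoids ⟨ X ⟩∷ Y.
gf-atom∷ : ∀ X Y → AtomOrEmpty Y →
     ⟦ ⟨ X ⟩∷ Y ⟧A ≈ 𝟙 ⊕ 𝕏 ⊗ (⟦ X ⟧A ⊗ ⟦ ⟨ X ⟩∷ Y ⟧A ⊕ (⟦ ⟨ X ⟩∷ Y ⟧A ⊕ ⊖ ⟦ X ⟧A) ⊗ ⟦ Y ⟧A)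
gf-atom∷ X Y aY zero = refl
gf-atom∷ X Y aY (suc m) =
  trans (cong ℤ.+_ (trans (count-enum-suc (avoids? P) m)
          (trans (count-split (λ p → avoids? P (node p)) (λ p → emb? X (proj₁ p)) pairs)
          (cong₂ _+_
             (trans (count-cong _ (both? (emb? X ∩? avoids? P) (avoids? Y)) containing⇒ ⇒containing pairs)
                    (count-convolve-enum (emb? X ∩? avoids? P) (avoids? Y) m))
             (trans (count-cong _ (both? (avoids? X) (avoids? P)) avoiding⇒ ⇒avoiding pairs)
                    (count-convolve-enum (avoids? X) (avoids? P) m))))))
  (trans (ℤₚ.pos-+ (cauchy d (avCount Y) m) (cauchy (avCount X) (avCount P) m))
  (trans (cong₂ _+ℤ_ (trans (⟦cauchy⟧ d (avCount Y) m) (⊗-cong (⟦containsButAvoids⟧ X Y) ≈-refl m)) (⟦cauchy⟧ (avCount X) (avCount P) m))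
  (trans (ℤₚ.+-comm (((⟦ P ⟧A ⊕ ⊖ ⟦ X ⟧A) ⊗ ⟦ Y ⟧A) m) ((⟦ X ⟧A ⊗ ⟦ P ⟧A) m)) (sym (trans (ℤₚ.+-identityˡ _) (𝕏⊗-suc _ m))))))
  where
  P = ⟨ X ⟩∷ Y
  pairs = convolve (enumWithFuel m) (enumWithFuel m) m
  d = containsButAvoids X P
  containing⇒ : ∀ p → (¬ Emb P (node p)) × Emb X (proj₁ p) → (Emb X (proj₁ p) × ¬ Emb P (proj₁ p)) × ¬ Emb Y (proj₂ p)
  containing⇒ (C , R) (ne , ex) = (ex , λ e → ne (emb-atom∷⁺ X Y C R (inj₂ (inj₂ e)))) , λ e → ne (emb-atom∷⁺ X Y C R (inj₁ (ex , e)))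
  ⇒containing : ∀ p → (Emb X (proj₁ p) × ¬ Emb P (proj₁ p)) × ¬ Emb Y (proj₂ p) → (¬ Emb P (node p)) × Emb X (proj₁ p)
  ⇒containing (C , R) ((ex , nc) , ny) = (λ e → [ (λ (_ , ey) → ny ey) , [ (λ er → ny (emb-trans (emb-tail X Y) er)) , nc ]′ ]′ (emb-atom∷⁻ X Y C R aY e)) , ex
  avoiding⇒ : ∀ p → (¬ Emb P (node p)) × ¬ Emb X (proj₁ p) → ¬ Emb X (proj₁ p) × ¬ Emb P (proj₂ p)
  avoiding⇒ (C , R) (ne , nx) = nx , λ e → ne (emb-atom∷⁺ X Y C R (inj₂ (inj₁ e)))
  ⇒avoiding : ∀ p → ¬ Emb X (proj₁ p) × ¬ Emb P (proj₂ p) → (¬ Emb P (node p)) × ¬ Emb X (proj₁ p)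
  ⇒avoiding (C , R) (nx , nr) = (λ e → [ (λ (ex , _) → nx ex) , [ nr , (λ ec → nx (emb-trans (emb-content X Y) ec)) ]′ ]′ (emb-atom∷⁻ X Y C R aY e)) , nx

≈-by-combination₁ : ∀ {a b p q} w → a ⊕ ⊖ b ≈ w ⊗ (p ⊕ ⊖ q) → p ≈ q → a ≈ b
≈-by-combination₁ w id e = difference≈𝟘⇒≈ (≈-trans id (⊗-≈𝟘 w (≈⇒difference≈𝟘 e)))

≈-by-combination₂ : ∀ {a b p1 q1 p2 q2} w1 w2 → a ⊕ ⊖ b ≈ w1 ⊗ (p1 ⊕ ⊖ q1) ⊕ w2 ⊗ (p2 ⊕ ⊖ q2) → p1 ≈ q1 → p2 ≈ q2 → a ≈ b
≈-by-combination₂ w1 w2 id e1 e2 = difference≈𝟘⇒≈ (≈-trans id (⊕-≈𝟘 (⊗-≈𝟘 w1 (≈⇒difference≈𝟘 e1)) (⊗-≈𝟘 w2 (≈⇒difference≈𝟘 e2))))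

-- Since 1 − x f g is a unit this equation determines A, and it is symmetric in f and g.
ConcatEquation : Series → Series → Series → Set
ConcatEquation A f g = A ⊗ (𝟙 ⊕ ⊖ (𝕏 ⊗ f ⊗ g)) ≈ f ⊕ g ⊕ ⊖ (f ⊗ g)

gf-concat : ∀ x Y → AtomOrEmpty x → AtomOrEmpty Y → ConcatEquation ⟦ x ++ Y ⟧A ⟦ x ⟧A ⟦ Y ⟧A
gf-concat .ε Y empty aY = ≈-by-combination₁ {p = ⟦ ε ⟧A} {q = 𝟘} (⊖ (𝕏 ⊗ ⟦ Y ⟧A ⊗ ⟦ Y ⟧A) ⊕ ⊖ 𝟙 ⊕ ⟦ Y ⟧A)
   (solve 3 (λ g z x → g :* (con 1ℤ :- x :* z :* g) :- (z :+ g :- z :* g) :=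
                        (:- (x :* g :* g) :- con 1ℤ :+ g) :* (z :- con 0ℤ)) (λ n → refl) ⟦ Y ⟧A ⟦ ε ⟧A 𝕏)
   (λ n → trans (cong ℤ.+_ (avCount-ε n)) (sym (𝟘≈0 n)))
gf-concat .(⟨ X ⟩∷ ε) Y (atom X) aY =
  difference≈𝟘⇒≈ (unit⊗≈𝟘 (𝟙 ⊕ ⊖ (𝕏 ⊗ c)) _ refl
    (≈-trans (ident A f g c 𝕏) (⊕-≈𝟘 (≈⇒difference≈𝟘 (gf-atom∷ X Y aY)) (⊗-≈𝟘 _ (≈⇒difference≈𝟘 (gf-atom X))))))
  where
  A = ⟦ ⟨ X ⟩∷ Y ⟧A
  f = ⟦ ⟨ X ⟩∷ ε ⟧A
  g = ⟦ Y ⟧A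
  c = ⟦ X ⟧A
  ident : ∀ A f g c x → (𝟙 ⊕ ⊖ (x ⊗ c)) ⊗ (A ⊗ (𝟙 ⊕ ⊖ (x ⊗ f ⊗ g)) ⊕ ⊖ (f ⊕ g ⊕ ⊖ (f ⊗ g))) ≈
      (A ⊕ ⊖ (𝟙 ⊕ x ⊗ (c ⊗ A ⊕ (A ⊕ ⊖ c) ⊗ g))) ⊕ (g ⊕ ⊖ 𝟙 ⊕ ⊖ (x ⊗ g ⊗ A)) ⊗ (f ⊕ ⊖ (𝟙 ⊕ x ⊗ (c ⊗ f)))
  ident = solve 5 (λ A f g c x → (con 1ℤ :- x :* c) :* (A :* (con 1ℤ :- x :* f :* g) :- (f :+ g :- f :* g)) :=
      (A :- (con 1ℤ :+ x :* (c :* A :+ (A :- c) :* g))) :+ (g :- con 1ℤ :- x :* g :* A) :* (f :- (con 1ℤ :+ x :* (c :* f))))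
      (λ n → refl)

-- ⟦ ⟨ A ⟩ ⟧A is the unique solution F of (1 − x ⟦ A ⟧A) F = 1.
gf-⟨⟩-cong : ∀ A B → ⟦ A ⟧A ≈ ⟦ B ⟧A → ⟦ ⟨ A ⟩∷ ε ⟧A ≈ ⟦ ⟨ B ⟩∷ ε ⟧A
gf-⟨⟩-cong A B e = ⊗-cancelˡ-unit (𝟙 ⊕ ⊖ (𝕏 ⊗ ⟦ A ⟧A)) _ _ refl
  (≈-trans (≈-by-combination₁ {p = FA} {q = 𝟙 ⊕ 𝕏 ⊗ (⟦ A ⟧A ⊗ FA)} 𝟙
            (solve 3 (λ a F x → (con 1ℤ :- x :* a) :* F :- con 1ℤ := con 1ℤ :* (F :- (con 1ℤ :+ x :* (a :* F)))) (λ n → refl) ⟦ A ⟧A FA 𝕏)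
            (gf-atom A))
  (≈-sym (≈-trans (⊗-cong (⊕-cong (≈-refl {𝟙}) (⊖-cong (⊗-cong (≈-refl {𝕏}) e))) (≈-refl {FB}))
          (≈-by-combination₁ {p = FB} {q = 𝟙 ⊕ 𝕏 ⊗ (⟦ B ⟧A ⊗ FB)} 𝟙
            (solve 3 (λ a F x → (con 1ℤ :- x :* a) :* F :- con 1ℤ := con 1ℤ :* (F :- (con 1ℤ :+ x :* (a :* F)))) (λ n → refl) ⟦ B ⟧A FB 𝕏)
            (gf-atom B)))))
  where
  FA = ⟦ ⟨ A ⟩∷ ε ⟧A
  FB = ⟦ ⟨ B ⟩∷ ε ⟧A

-- Subtracting the gf-atom equations for A and B leaves x (⟦ A ⟧A − ⟦ B ⟧A) ⟦ ⟨ A ⟩ ⟧A = 0.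
gf-⟨⟩-injective : ∀ A B → ⟦ ⟨ A ⟩∷ ε ⟧A ≈ ⟦ ⟨ B ⟩∷ ε ⟧A → ⟦ A ⟧A ≈ ⟦ B ⟧A
gf-⟨⟩-injective A B e = difference≈𝟘⇒≈ (unit⊗≈𝟘 FA (⟦ A ⟧A ⊕ ⊖ ⟦ B ⟧A) refl
   (≈-trans (⊗-comm FA _) (𝕏⊗≈𝟘 _ (≈-by-combination₂ {p1 = FA} {q1 = 𝟙 ⊕ 𝕏 ⊗ (⟦ B ⟧A ⊗ FA)} {p2 = FA} {q2 = 𝟙 ⊕ 𝕏 ⊗ (⟦ A ⟧A ⊗ FA)} 𝟙 (⊖ 𝟙)
      (solve 4 (λ a b F x → x :* ((a :- b) :* F) :- con 0ℤ :=
            con 1ℤ :* (F :- (con 1ℤ :+ x :* (b :* F))) :+ (:- con 1ℤ) :* (F :- (con 1ℤ :+ x :* (a :* F)))) (λ n → refl) ⟦ A ⟧A ⟦ B ⟧A FA 𝕏)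
      (≈-trans e (≈-trans (gf-atom B) (⊕-cong (≈-refl {𝟙}) (⊗-cong (≈-refl {𝕏}) (⊗-cong (≈-refl {⟦ B ⟧A}) (≈-sym e))))))
      (gf-atom A)))))
  where
  FA = ⟦ ⟨ A ⟩∷ ε ⟧A

gf-swap : ∀ a b → AtomOrEmpty a → AtomOrEmpty b → ⟦ a ++ b ⟧A ≈ ⟦ b ++ a ⟧A
gf-swap a b aa ab = ⊗-cancelˡ-unit (𝟙 ⊕ ⊖ (𝕏 ⊗ ⟦ a ⟧A ⊗ ⟦ b ⟧A)) _ _ refl
  (≈-trans (⊗-comm _ _) (≈-trans (gf-concat a b aa ab)
   (≈-sym (≈-trans (⊗-comm _ _) (≈-by-combination₁ {p = ⟦ b ++ a ⟧A ⊗ (𝟙 ⊕ ⊖ (𝕏 ⊗ ⟦ b ⟧A ⊗ ⟦ a ⟧A))} {q = ⟦ b ⟧A ⊕ ⟦ a ⟧A ⊕ ⊖ (⟦ b ⟧A ⊗ ⟦ a ⟧A)} 𝟙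
     (solve 4 (λ n f g x → n :* (con 1ℤ :- x :* f :* g) :- (f :+ g :- f :* g) :=
        con 1ℤ :* (n :* (con 1ℤ :- x :* g :* f) :- (g :+ f :- g :* f))) (λ n → refl) ⟦ b ++ a ⟧A ⟦ a ⟧A ⟦ b ⟧A 𝕏)
     (gf-concat b a ab aa))))))

≈-by-combination₃ : ∀ {a b p1 q1 p2 q2 p3 q3} w1 w2 w3 → a ⊕ ⊖ b ≈ w1 ⊗ (p1 ⊕ ⊖ q1) ⊕ w2 ⊗ (p2 ⊕ ⊖ q2) ⊕ w3 ⊗ (p3 ⊕ ⊖ q3) →
         p1 ≈ q1 → p2 ≈ q2 → p3 ≈ q3 → a ≈ b
≈-by-combination₃ w1 w2 w3 id e1 e2 e3 = difference≈𝟘⇒≈ (≈-trans id (⊕-≈𝟘 (⊕-≈𝟘 (⊗-≈𝟘 w1 (≈⇒difference≈𝟘 e1)) (⊗-≈𝟘 w2 (≈⇒difference≈𝟘 e2))) (⊗-≈𝟘 w3 (≈⇒difference≈𝟘 e3))))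

-- Both sides of R4 satisfy A · D = N with D and N invariant under rotating ⟦ a ⟧A, ⟦ b ⟧A, ⟦ c ⟧A.
R4Denominator R4Numerator : Series → Series → Series → Series
R4Denominator f g h = 𝟙 ⊕ ⊖ (𝕏 ⊗ (f ⊕ g ⊕ h)) ⊕ 𝕏 ⊗ 𝕏 ⊗ f ⊗ g ⊗ h
R4Numerator f g h = 𝟙 ⊕ ⊖ (𝕏 ⊗ (f ⊗ g ⊕ g ⊗ h ⊕ f ⊗ h)) ⊕ 𝕏 ⊗ f ⊗ g ⊗ h

gf-R4-core : ∀ n f m k g h → ConcatEquation n f m → m ≈ 𝟙 ⊕ 𝕏 ⊗ (k ⊗ m) → ConcatEquation k g h → n ⊗ R4Denominator f g h ≈ R4Numerator f g h
gf-R4-core n f m k g h e1 e2 e3 =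
  ≈-by-combination₃ ((𝟙 ⊕ ⊖ (𝕏 ⊗ g ⊗ h)) ⊗ (𝟙 ⊕ ⊖ (𝕏 ⊗ k))) (⊖ ((𝟙 ⊕ ⊖ (𝕏 ⊗ g ⊗ h)) ⊗ (f ⊕ ⊖ 𝟙 ⊕ ⊖ (𝕏 ⊗ f ⊗ n)))) (⊖ (𝕏 ⊗ (f ⊕ ⊖ n)))
    (ident n f m k g h 𝕏) e1 e2 e3
  where
  ident : ∀ n f m k g h x →
    n ⊗ (𝟙 ⊕ ⊖ (x ⊗ (f ⊕ g ⊕ h)) ⊕ x ⊗ x ⊗ f ⊗ g ⊗ h) ⊕ ⊖ (𝟙 ⊕ ⊖ (x ⊗ (f ⊗ g ⊕ g ⊗ h ⊕ f ⊗ h)) ⊕ x ⊗ f ⊗ g ⊗ h) ≈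
    ((𝟙 ⊕ ⊖ (x ⊗ g ⊗ h)) ⊗ (𝟙 ⊕ ⊖ (x ⊗ k))) ⊗ (n ⊗ (𝟙 ⊕ ⊖ (x ⊗ f ⊗ m)) ⊕ ⊖ (f ⊕ m ⊕ ⊖ (f ⊗ m)))
    ⊕ (⊖ ((𝟙 ⊕ ⊖ (x ⊗ g ⊗ h)) ⊗ (f ⊕ ⊖ 𝟙 ⊕ ⊖ (x ⊗ f ⊗ n)))) ⊗ (m ⊕ ⊖ (𝟙 ⊕ x ⊗ (k ⊗ m)))
    ⊕ (⊖ (x ⊗ (f ⊕ ⊖ n))) ⊗ (k ⊗ (𝟙 ⊕ ⊖ (x ⊗ g ⊗ h)) ⊕ ⊖ (g ⊕ h ⊕ ⊖ (g ⊗ h)))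
  ident = solve 7 (λ n f m k g h x →
     n :* (con 1ℤ :- x :* (f :+ g :+ h) :+ x :* x :* f :* g :* h) :- (con 1ℤ :- x :* (f :* g :+ g :* h :+ f :* h) :+ x :* f :* g :* h) :=
     ((con 1ℤ :- x :* g :* h) :* (con 1ℤ :- x :* k)) :* (n :* (con 1ℤ :- x :* f :* m) :- (f :+ m :- f :* m))
     :+ (:- ((con 1ℤ :- x :* g :* h) :* (f :- con 1ℤ :- x :* f :* n))) :* (m :- (con 1ℤ :+ x :* (k :* m)))
     :+ (:- (x :* (f :- n))) :* (k :* (con 1ℤ :- x :* g :* h) :- (g :+ h :- g :* h))) (λ n → refl)

ConcatEquation-swap : ∀ A f g → ConcatEquation A f g → ConcatEquation A g f
ConcatEquation-swap A f g e = ≈-by-combination₁ 𝟙 (solve 4 (λ A f g x → A :* (con 1ℤ :- x :* g :* f) :- (g :+ f :- g :* f) :=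
                                      con 1ℤ :* (A :* (con 1ℤ :- x :* f :* g) :- (f :+ g :- f :* g))) (λ n → refl) A f g 𝕏) e

gf-R4 : ∀ a b c → AtomOrEmpty a → AtomOrEmpty b → AtomOrEmpty c →
      ⟦ a ++ ⟨ b ++ c ⟩ ⟧A ≈ ⟦ ⟨ a ++ b ⟩ ++ c ⟧A
gf-R4 a b c aa ab ac = ⊗-cancelˡ-unit (R4Denominator fa fb fc) _ _ refl
  (≈-trans (⊗-comm _ _) (≈-trans e1 (≈-sym (≈-trans (⊗-comm _ _)
     (≈-trans (⊗-cong (≈-refl {⟦ ⟨ a ++ b ⟩ ++ c ⟧A}) (R4Denominator-rotate fa fb fc)) (≈-trans e2 (R4Numerator-rotate fc fa fb)))))))
  where
  fa = ⟦ a ⟧A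
  fb = ⟦ b ⟧A
  fc = ⟦ c ⟧A
  e1 = gf-R4-core ⟦ a ++ ⟨ b ++ c ⟩ ⟧A fa ⟦ ⟨ b ++ c ⟩ ⟧A ⟦ b ++ c ⟧A fb fc (gf-concat a ⟨ b ++ c ⟩ aa (atom (b ++ c))) (gf-atom (b ++ c)) (gf-concat b c ab ac)
  e2 = gf-R4-core ⟦ ⟨ a ++ b ⟩ ++ c ⟧A fc ⟦ ⟨ a ++ b ⟩ ⟧A ⟦ a ++ b ⟧A fa fb
         (ConcatEquation-swap _ _ _ (gf-concat ⟨ a ++ b ⟩ c (atom (a ++ b)) ac)) (gf-atom (a ++ b)) (gf-concat a b aa ab)
  R4Denominator-rotate : ∀ f g h → R4Denominator f g h ≈ R4Denominator h f g
  R4Denominator-rotate f g h = solve 4 (λ f g h x → (con 1ℤ :- x :* (f :+ g :+ h) :+ x :* x :* f :* g :* h) := (con 1ℤ :- x :* (h :+ f :+ g) :+ x :* x :* h :* f :* g)) (λ n → refl) f g h 𝕏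
  R4Numerator-rotate : ∀ f g h → R4Numerator f g h ≈ R4Numerator g h f
  R4Numerator-rotate f g h = solve 4 (λ f g h x → (con 1ℤ :- x :* (f :* g :+ g :* h :+ f :* h) :+ x :* f :* g :* h) := (con 1ℤ :- x :* (g :* h :+ h :* f :+ g :* f) :+ x :* g :* h :* f)) (λ n → refl) f g h 𝕏

-- Parenthesis words

-- A word w, balanced or not, reads d0 ) d1 ) … ) dk ( e1 ( … ( em with all dᵢ, eⱼ balanced; then
-- parse w = sg d0 [ d1 … dk ] [ e1 … em ], and arches w = d0 d1 … dk e1 … em is the arch system
-- left after erasing the unmatched parentheses.
data Paren : Set where
  op cl : Paren

Word : Set
Word = List Paren

record Segment : Set where
  constructor sg
  field
    d0 : Arch
    ds : List Arch
    es : List Arch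
open Segment

parseOpen : Segment → Segment
parseOpen (sg d0 [] es) = sg ε [] (d0 ∷ es)
parseOpen (sg d0 (d1 ∷ ds) es) = sg (⟨ d0 ⟩∷ d1) ds es

parseClose : Segment → Segment
parseClose (sg d0 ds es) = sg ε (d0 ∷ ds) es

parse : Word → Segment
parse [] = sg ε [] []
parse (op ∷ w) = parseOpen (parse w)
parse (cl ∷ w) = parseClose (parse w)

word : Arch → Word
word ε = []
word (⟨ C ⟩∷ R) = op ∷ (word C ++L (cl ∷ word R))

renderTail : List Arch → List Arch → Word
renderTail [] [] = []
renderTail (d1 ∷ ds) es = cl ∷ (word d1 ++L renderTail ds es)
renderTail [] (e1 ∷ es) = op ∷ (word e1 ++L renderTail [] es)

render : Segment → Word
render (sg d0 ds es) = word d0 ++L renderTail ds es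

concatAll : List Arch → Arch
concatAll [] = ε
concatAll (x ∷ xs) = x ++ concatAll xs

flat : Segment → Arch
flat (sg d0 ds es) = d0 ++ (concatAll ds ++ concatAll es)

arches : Word → Arch
arches w = flat (parse w)

parse-word++ : ∀ A y → parse (word A ++L y) ≡ sg (A ++ d0 (parse y)) (ds (parse y)) (es (parse y))
parse-word++ ε y = refl
parse-word++ (⟨ C ⟩∷ R) y
  rewrite ++L-assoc (word C) (cl ∷ word R) y
        | parse-word++ C (cl ∷ (word R ++L y))
        | parse-word++ R y
        | ++-identityʳ C = refl

parse-renderTail : ∀ ds es → parse (renderTail ds es) ≡ sg ε ds es
parse-renderTail [] [] = refl
parse-renderTail (d1 ∷ ds) es rewrite parse-word++ d1 (renderTail ds es) | parse-renderTail ds es | ++-identityʳ d1 = refl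
parse-renderTail [] (e1 ∷ es) rewrite parse-word++ e1 (renderTail [] es) | parse-renderTail [] es | ++-identityʳ e1 = refl

parse-render : ∀ s → parse (render s) ≡ s
parse-render (sg d0 ds es) rewrite parse-word++ d0 (renderTail ds es) | parse-renderTail ds es | ++-identityʳ d0 = refl

render-parse : ∀ w → render (parse w) ≡ w
render-parse [] = refl
render-parse (cl ∷ w) with parse w | render-parse w
... | sg d0 ds es | ih = cong (cl ∷_) ih
render-parse (op ∷ w) with parse w | render-parse w
... | sg d0 [] es | ih = cong (op ∷_) ih
... | sg d0 (d1 ∷ ds) es | ih =
  cong (op ∷_) (trans (++L-assoc (word d0) (cl ∷ word d1) (renderTail ds es)) ih)

arches-word++ : ∀ A y → arches (word A ++L y) ≡ A ++ arches y
arches-word++ A y rewrite parse-word++ A y = ++-assoc A _ _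

arches-close : ∀ y → arches (cl ∷ y) ≡ arches y
arches-close y with parse y
... | sg d0 ds es = ++-assoc d0 (concatAll ds) (concatAll es)

arches-open : ∀ y → Emb (arches y) (arches (op ∷ y))
arches-open y with parse y
... | sg d0 [] es = emb-refl _
... | sg d0 (d1 ∷ ds) es = esplit d0 (d1 ++ (concatAll ds ++ concatAll es)) (cong (d0 ++_) (++-assoc d1 (concatAll ds) (concatAll es))) (emb-refl d0) (emb-refl _)

arches-∷ : ∀ c y → Emb (arches y) (arches (c ∷ y))
arches-∷ op y = arches-open y
arches-∷ cl y = subst (Emb (arches y)) (sym (arches-close y)) (emb-refl _)

arches-word : ∀ A → arches (word A) ≡ A
arches-word A = trans (cong arches (sym (++L-identityʳ (word A)))) (trans (arches-word++ A []) (++-identityʳ A))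

glue-tail : ∀ ds es v → Emb ((concatAll ds ++ concatAll es) ++ arches v) (arches (renderTail ds es ++L v))
glue-tail [] [] v = emb-refl _
glue-tail (d1 ∷ ds) es v = subst₂ Emb (sym eqL) (sym eqR) (emb-++ (emb-refl d1) (glue-tail ds es v))
  where
  eqL : ((d1 ++ concatAll ds) ++ concatAll es) ++ arches v ≡ d1 ++ ((concatAll ds ++ concatAll es) ++ arches v)
  eqL = trans (cong (_++ arches v) (++-assoc d1 (concatAll ds) (concatAll es))) (++-assoc d1 _ (arches v))
  eqR : arches (cl ∷ ((word d1 ++L renderTail ds es) ++L v)) ≡ d1 ++ arches (renderTail ds es ++L v)
  eqR = trans (arches-close ((word d1 ++L renderTail ds es) ++L v)) (trans (cong arches (++L-assoc (word d1) (renderTail ds es) v)) (arches-word++ d1 (renderTail ds es ++L v)))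
glue-tail [] (e1 ∷ es) v = emb-trans (subst₂ Emb (sym eqL) (sym eqR) (emb-++ (emb-refl e1) (glue-tail [] es v))) (arches-open ((word e1 ++L renderTail [] es) ++L v))
  where
  eqL : (e1 ++ concatAll es) ++ arches v ≡ e1 ++ (concatAll es ++ arches v)
  eqL = ++-assoc e1 (concatAll es) (arches v)
  eqR : arches ((word e1 ++L renderTail [] es) ++L v) ≡ e1 ++ arches (renderTail [] es ++L v)
  eqR = trans (cong arches (++L-assoc (word e1) (renderTail [] es) v)) (arches-word++ e1 (renderTail [] es ++L v))

glue-segment : ∀ s v → Emb (arches (render s) ++ arches v) (arches (render s ++L v))
glue-segment (sg d0 ds es) v = subst₂ Emb (sym eqL) (sym eqR) (emb-++ (emb-refl d0) (glue-tail ds es v))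
  where
  eqL : arches (render (sg d0 ds es)) ++ arches v ≡ d0 ++ ((concatAll ds ++ concatAll es) ++ arches v)
  eqL = trans (cong (λ s → flat s ++ arches v) (parse-render (sg d0 ds es))) (++-assoc d0 _ (arches v))
  eqR : arches (render (sg d0 ds es) ++L v) ≡ d0 ++ arches (renderTail ds es ++L v)
  eqR = trans (cong arches (++L-assoc (word d0) (renderTail ds es) v)) (arches-word++ d0 (renderTail ds es ++L v))

-- Concatenation can only match previously unmatched parentheses, i.e. create arches.
glue : ∀ u v → Emb (arches u ++ arches v) (arches (u ++L v))
glue u v = subst (λ u' → Emb (arches u' ++ arches v) (arches (u' ++L v))) (render-parse u) (glue-segment (parse u) v)

++-overlap : ∀ G1 G2 K1 K2 → G1 ++ G2 ≡ K1 ++ K2 →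
  Σ Arch λ M → ((G1 ≡ K1 ++ M) × (K2 ≡ M ++ G2)) ⊎ ((K1 ≡ G1 ++ M) × (G2 ≡ M ++ K2))
++-overlap ε G2 K1 K2 eq = K1 , inj₂ (refl , eq)
++-overlap (⟨ X ⟩∷ G1) G2 ε K2 eq = (⟨ X ⟩∷ G1) , inj₁ (refl , sym eq)
++-overlap (⟨ X ⟩∷ G1) G2 (⟨ Y ⟩∷ K1) K2 eq with ⟨⟩∷-injectiveˡ eq | ++-overlap G1 G2 K1 K2 (⟨⟩∷-injectiveʳ eq)
... | refl | M , inj₁ (a , b) = M , inj₁ (cong (⟨ X ⟩∷_) a , b)
... | refl | M , inj₂ (a , b) = M , inj₂ (cong (⟨ X ⟩∷_) a , b)

Cut : Word → Arch → Arch → Set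
Cut w G1 G2 = Σ ℕ λ i → (i ≤ length w) × Emb G1 (arches (take i w)) × Emb G2 (arches (drop i w))

arches-atom : ∀ C t → arches (op ∷ (word C ++L (cl ∷ t))) ≡ ⟨ C ⟩∷ arches t
arches-atom C t = trans (cong (λ z → arches (op ∷ z)) (sym (++L-assoc (word C) (cl ∷ []) t))) (arches-word++ (⟨ C ⟩∷ ε) t)

cut-word : ∀ D G1 G2 → Emb (G1 ++ G2) D → Cut (word D) G1 G2
cut-word ε G1 G2 e with ++-conical G1 G2 (emb-into-ε e)
... | refl , refl = 0 , z≤n , enil , enil
cut-word (⟨ C ⟩∷ R) ε G2 e = 0 , z≤n , enil , subst (Emb G2) (sym (arches-word (⟨ C ⟩∷ R))) e
cut-word (⟨ C ⟩∷ R) (⟨ H ⟩∷ G1) G2 e = go e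
  where
  w = word (⟨ C ⟩∷ R)
  lC = length (word C)
  cutInTail : ∀ j → j ≤ length (word R) → (take (suc (lC + suc j)) w ≡ op ∷ (word C ++L (cl ∷ take j (word R)))) × (drop (suc (lC + suc j)) w ≡ drop j (word R)) × (suc (lC + suc j) ≤ length w)
  cutInTail j p = cong (op ∷_) (take-++-length (word C) (cl ∷ word R) (suc j)) , drop-++-length (word C) (cl ∷ word R) (suc j) ,
                 s≤s (subst (lC + suc j ≤_) (sym (length-++ (word C))) (ℕₚ.+-monoʳ-≤ lC (s≤s p)))
  go : Emb ((⟨ H ⟩∷ G1) ++ G2) (⟨ C ⟩∷ R) → Cut w (⟨ H ⟩∷ G1) G2
  go (eroot e1 e2) with cut-word R G1 G2 e2
  ... | j , p , a , b with cutInTail j p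
  ...   | t , d , q = suc (lC + suc j) , q ,
          subst (Emb (⟨ H ⟩∷ G1)) (sym (trans (cong arches t) (arches-atom C (take j (word R))))) (eroot e1 a) ,
          subst (Emb G2) (sym (cong arches d)) b
  go (esplit K1 K2 eq e1 e2) with ++-overlap (⟨ H ⟩∷ G1) G2 K1 K2 eq
  ... | M , inj₁ (a1 , b1) with cut-word R M G2 (subst (λ z → Emb z R) b1 e2)
  ...   | j , p , a , b with cutInTail j p
  ...     | t , d , q = suc (lC + suc j) , q ,
          subst₂ Emb (sym a1) (sym (trans (cong arches t) (arches-atom C (take j (word R))))) (esplit K1 M refl e1 a) ,
          subst (Emb G2) (sym (cong arches d)) b
  go (esplit K1 K2 eq e1 e2) | M , inj₂ (a2 , b2) with cut-word C (⟨ H ⟩∷ G1) M (subst (λ z → Emb z C) a2 e1)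
  ... | j , p , a , b = suc j , s≤s (ℕₚ.≤-trans p (subst (lC ≤_) (sym (length-++ (word C))) (ℕₚ.m≤m+n lC _))) ,
          emb-trans a (subst (λ z → Emb (arches (take j (word C))) (arches (op ∷ z))) (sym (take-++-within (word C) (cl ∷ word R) j p)) (arches-open (take j (word C)))) ,
          subst₂ Emb (sym b2) (cong arches (sym (drop-++-within (word C) (cl ∷ word R) j p)))
            (emb-trans (emb-++ b (subst (Emb K2) (sym (trans (arches-close (word R)) (arches-word R))) e2)) (glue (drop j (word C)) (cl ∷ word R)))

cut-step : ∀ d0 c w' → (∀ G1 G2 → Emb (G1 ++ G2) (arches w') → Cut w' G1 G2) → arches (c ∷ w') ≡ arches w' →
          ∀ G1 G2 → Emb (G1 ++ G2) (d0 ++ arches w') → Cut (word d0 ++L (c ∷ w')) G1 G2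
cut-step d0 c w' IH eqc G1 G2 e with emb-++⁻ d0 (arches w') e
... | K1 , K2 , eq , e1 , e2 with ++-overlap G1 G2 K1 K2 eq
...   | M , inj₁ (a1 , b1) with IH M G2 (subst (λ z → Emb z (arches w')) b1 e2)
...     | j , p , a , b =
  length (word d0) + suc j ,
  subst (length (word d0) + suc j ≤_) (sym (length-++ (word d0))) (ℕₚ.+-monoʳ-≤ (length (word d0)) (s≤s p)) ,
  subst₂ Emb (sym a1) (sym (trans (cong arches (take-++-length (word d0) (c ∷ w') (suc j))) (arches-word++ d0 (c ∷ take j w'))))
    (emb-++ e1 (emb-trans a (arches-∷ c (take j w')))) ,
  subst (Emb G2) (sym (cong arches (drop-++-length (word d0) (c ∷ w') (suc j)))) b
cut-step d0 c w' IH eqc G1 G2 e | K1 , K2 , eq , e1 , e2 | M , inj₂ (a2 , b2) with cut-word d0 G1 M (subst (λ z → Emb z d0) a2 e1)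
... | j , p , a , b =
  j , ℕₚ.≤-trans p (subst (length (word d0) ≤_) (sym (length-++ (word d0))) (ℕₚ.m≤m+n _ _)) ,
  subst (Emb G1) (cong arches (sym (take-++-within (word d0) (c ∷ w') j p))) a ,
  subst₂ Emb (sym b2) (cong arches (sym (drop-++-within (word d0) (c ∷ w') j p)))
    (emb-trans (emb-++ b (subst (Emb K2) (sym eqc) e2)) (glue (drop j (word d0)) (c ∷ w')))

arches-open-unmatched : ∀ e1 es → arches (op ∷ render (sg e1 [] es)) ≡ arches (render (sg e1 [] es))
arches-open-unmatched e1 es rewrite parse-render (sg e1 [] es) = refl

cut-render : ∀ d0 ds es G1 G2 → Emb (G1 ++ G2) (arches (render (sg d0 ds es))) → Cut (render (sg d0 ds es)) G1 G2
cut-render d0 [] [] G1 G2 e = subst (λ w → Cut w G1 G2) (sym (++L-identityʳ (word d0)))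
  (cut-word d0 G1 G2 (subst (Emb (G1 ++ G2)) (trans (cong arches (++L-identityʳ (word d0))) (arches-word d0)) e))
cut-render d0 (d1 ∷ ds) es G1 G2 e =
  cut-step d0 cl (render (sg d1 ds es)) (cut-render d1 ds es) (arches-close (render (sg d1 ds es))) G1 G2
    (subst (Emb (G1 ++ G2)) (trans (arches-word++ d0 (cl ∷ render (sg d1 ds es))) (cong (d0 ++_) (arches-close (render (sg d1 ds es))))) e)
cut-render d0 [] (e1 ∷ es) G1 G2 e =
  cut-step d0 op (render (sg e1 [] es)) (cut-render e1 [] es) (arches-open-unmatched e1 es) G1 G2
    (subst (Emb (G1 ++ G2)) (trans (arches-word++ d0 (op ∷ render (sg e1 [] es))) (cong (d0 ++_) (arches-open-unmatched e1 es))) e)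

cut : ∀ w G1 G2 → Emb (G1 ++ G2) (arches w) → Cut w G1 G2
cut w G1 G2 e = subst (λ w' → Cut w' G1 G2) (render-parse w)
  (cut-render (d0 (parse w)) (ds (parse w)) (es (parse w)) G1 G2 (subst (λ w' → Emb (G1 ++ G2) (arches w')) (sym (render-parse w)) e))

uncut : ∀ w i G1 G2 → Emb G1 (arches (take i w)) → Emb G2 (arches (drop i w)) → Emb (G1 ++ G2) (arches w)
uncut w i G1 G2 a b = subst (λ z → Emb (G1 ++ G2) (arches z)) (take++drop≡id i w) (emb-trans (emb-++ a b) (glue (take i w) (drop i w)))

-- (number of unmatched ')' , number of unmatched '(')
profile : Word → ℕ × ℕ
profile w = length (ds (parse w)) , length (es (parse w))

profile-step : Paren → ℕ × ℕ → ℕ × ℕ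
profile-step cl (k , m) = suc k , m
profile-step op (zero , m) = zero , suc m
profile-step op (suc k , m) = k , m

profile-∷ : ∀ c w → profile (c ∷ w) ≡ profile-step c (profile w)
profile-∷ cl w = refl
profile-∷ op w with parse w
... | sg d0 [] es = refl
... | sg d0 (d1 ∷ ds) es = refl

-- The unmatched ')' of the right word cancel against the unmatched '(' of the left one.
profile-combine : ℕ × ℕ → ℕ × ℕ → ℕ × ℕ
profile-combine (a , b) (k , m) = a + (k ∸ b) , (b ∸ k) + m

profile-combine-open : ∀ k b m → (k ∸ suc b , (suc b ∸ k) + m) ≡ profile-step op (k ∸ b , (b ∸ k) + m)
profile-combine-open zero b m rewrite ℕₚ.0∸n≡0 b = refl
profile-combine-open (suc k) zero m rewrite ℕₚ.0∸n≡0 k = refl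
profile-combine-open (suc k) (suc b) m = profile-combine-open k b m

profile-combine-step : ∀ c p q → profile-combine (profile-step c p) q ≡ profile-step c (profile-combine p q)
profile-combine-step cl (a , b) (k , m) = refl
profile-combine-step op (zero , b) (k , m) = profile-combine-open k b m
profile-combine-step op (suc a , b) (k , m) = refl

profile-++ : ∀ u v → profile (u ++L v) ≡ profile-combine (profile u) (profile v)
profile-++ [] v rewrite ℕₚ.0∸n≡0 (proj₁ (profile v)) = refl
profile-++ (c ∷ u) v = trans (profile-∷ c (u ++L v)) (trans (cong (profile-step c) (profile-++ u v))
                       (trans (sym (profile-combine-step c (profile u) (profile v))) (cong (λ p → profile-combine p (profile v)) (sym (profile-∷ c u)))))

parse-word : ∀ A → parse (word A) ≡ sg A [] []
parse-word A = trans (cong parse (sym (++L-identityʳ (word A)))) (trans (parse-word++ A []) (cong (λ z → sg z [] []) (++-identityʳ A)))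

profile-word : ∀ A → profile (word A) ≡ (0 , 0)
profile-word A rewrite parse-word A = refl

balanced⇒word : ∀ w → profile w ≡ (0 , 0) → w ≡ word (arches w)
balanced⇒word w e with parse w | render-parse w | cong proj₁ e | cong proj₂ e
... | sg d0 ds es | eq | e1 | e2 with length≡0⇒[] ds e1 | length≡0⇒[] es e2
... | refl | refl = trans (sym eq) (trans (++L-identityʳ (word d0)) (cong word (sym (++-identityʳ d0))))

length-word : ∀ A → length (word A) ≡ size A + size A
length-word ε = refl
length-word (⟨ C ⟩∷ R) = cong suc (trans (length-++ (word C))
   (trans (cong₂ (λ x y → x + suc y) (length-word C) (length-word R)) (arith (size C) (size R))))
  where
  arith : ∀ c r → (c + c) + suc (r + r) ≡ (c + r) + suc (c + r)
  arith = solve-∀ℕ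

double-injective : ∀ a b → a + a ≡ b + b → a ≡ b
double-injective zero zero e = refl
double-injective zero (suc b) ()
double-injective (suc a) zero ()
double-injective (suc a) (suc b) e = cong suc (double-injective a b (ℕₚ.suc-injective (trans (sym (ℕₚ.+-suc a a)) (trans (ℕₚ.suc-injective e) (ℕₚ.+-suc b b)))))

arches-drop-mono : ∀ w i j → i ≤ j → Emb (arches (drop j w)) (arches (drop i w))
arches-drop-mono w i j p = subst (λ z → Emb (arches (drop j w)) (arches z)) (take++drop≡id (j ∸ i) (drop i w))
  (emb-trans (emb-++ˡ (arches (take (j ∸ i) (drop i w))) (subst (λ z → Emb (arches (drop j w)) (arches z)) eq (emb-refl _)))
             (glue (take (j ∸ i) (drop i w)) (drop (j ∸ i) (drop i w))))
  where
  eq : drop j w ≡ drop (j ∸ i) (drop i w)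
  eq = sym (trans (drop-drop i (j ∸ i) w) (cong (λ z → drop z w) (ℕₚ.m+[n∸m]≡n p)))

arches-take-mono : ∀ w i j → i ≤ j → Emb (arches (take i w)) (arches (take j w))
arches-take-mono w i j p = subst (λ z → Emb (arches (take i w)) (arches z)) (take++drop≡id i (take j w))
  (emb-trans (emb-++ʳ (arches (drop i (take j w))) (subst (λ z → Emb (arches (take i w)) (arches z)) eq (emb-refl _)))
             (glue (take i (take j w)) (drop i (take j w))))
  where
  eq : take i w ≡ take i (take j w)
  eq = sym (trans (take-take i j w) (cong (λ z → take z w) (ℕₚ.m≤n⇒m⊓n≡m p)))

-- Least and greatest witnesses below a bound

data LeastSearch (E : ℕ → Set) (n : ℕ) : Set where
  found : (m : ℕ) → m ≤ n → E m → (∀ j → j < m → ¬ E j) → LeastSearch E n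
  none : (∀ j → j ≤ n → ¬ E j) → LeastSearch E n

leastSearch : (E : ℕ → Set) → (∀ j → Dec (E j)) → (n : ℕ) → LeastSearch E n
leastSearch E E? zero with E? 0
... | yes e = found 0 z≤n e (λ j ())
... | no ne = none λ { zero z≤n → ne }
leastSearch E E? (suc n) with leastSearch E E? n
... | found m p e b = found m (ℕₚ.m≤n⇒m≤1+n p) e b
... | none h with E? (suc n)
...   | yes e = found (suc n) ℕₚ.≤-refl e (λ j j<sn → h j (ℕₚ.≤-pred j<sn))
...   | no ne = none helper
  where
  helper : ∀ j → j ≤ suc n → ¬ E j
  helper j j≤ with ℕₚ.m≤n⇒m<n∨m≡n j≤
  ... | inj₁ j< = h j (ℕₚ.≤-pred j<)
  ... | inj₂ refl = ne

leastPos : ∀ {E n} → LeastSearch E n → ℕ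
leastPos (found m _ _ _) = m
leastPos {n = n} (none _) = n

leastPos≤ : ∀ {E n} (r : LeastSearch E n) → leastPos r ≤ n
leastPos≤ (found m p _ _) = p
leastPos≤ (none _) = ℕₚ.≤-refl

leastPos-hit : ∀ {E n} (r : LeastSearch E n) j → j ≤ n → E j → E (leastPos r) × (leastPos r ≤ j)
leastPos-hit (found m p e b) j j≤ ej with ℕₚ.<-cmp j m
... | tri< j<m _ _ = ⊥-elim (b j j<m ej)
... | tri≈ _ refl _ = e , ℕₚ.≤-refl
... | tri> _ _ m<j = e , ℕₚ.<⇒≤ m<j
leastPos-hit (none h) j j≤ ej = ⊥-elim (h j j≤ ej)

leastPos-unique : ∀ {E n} (r : LeastSearch E n) m → m ≤ n → E m → (∀ j → j < m → ¬ E j) → leastPos r ≡ m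
leastPos-unique (found m' p e b) m q e' b' with ℕₚ.<-cmp m' m
... | tri< m'<m _ _ = ⊥-elim (b' m' m'<m e)
... | tri≈ _ eq _ = eq
... | tri> _ _ m<m' = ⊥-elim (b m m<m' e')
leastPos-unique (none h) m q e' b' = ⊥-elim (h m q e')

leastPos-none : ∀ {E n} (r : LeastSearch E n) → (∀ j → j ≤ n → ¬ E j) → leastPos r ≡ n
leastPos-none (found m p e b) h = ⊥-elim (h m p e)
leastPos-none (none _) h = refl

data GreatestSearch (E : ℕ → Set) (n : ℕ) : Set where
  foundMax : (m : ℕ) → m ≤ n → E m → (∀ j → m < j → j ≤ n → ¬ E j) → GreatestSearch E n
  noneMax : (∀ j → j ≤ n → ¬ E j) → GreatestSearch E n

greatestSearch : (E : ℕ → Set) → (∀ j → Dec (E j)) → (n : ℕ) → GreatestSearch E n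
greatestSearch E E? n with E? n
... | yes e = foundMax n ℕₚ.≤-refl e (λ j n<j j≤n → ⊥-elim (ℕₚ.<⇒≱ n<j j≤n))
greatestSearch E E? zero | no ne = noneMax λ { zero z≤n → ne }
greatestSearch E E? (suc n) | no ne with greatestSearch E E? n
... | foundMax m p e b = foundMax m (ℕₚ.m≤n⇒m≤1+n p) e helper
  where
  helper : ∀ j → m < j → j ≤ suc n → ¬ E j
  helper j m<j j≤ with ℕₚ.m≤n⇒m<n∨m≡n j≤
  ... | inj₁ j< = b j m<j (ℕₚ.≤-pred j<)
  ... | inj₂ refl = ne
... | noneMax h = noneMax helper
  where
  helper : ∀ j → j ≤ suc n → ¬ E j
  helper j j≤ with ℕₚ.m≤n⇒m<n∨m≡n j≤
  ... | inj₁ j< = h j (ℕₚ.≤-pred j<)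
  ... | inj₂ refl = ne

greatestPos : ∀ {E n} → GreatestSearch E n → ℕ
greatestPos (foundMax m _ _ _) = m
greatestPos (noneMax _) = 0

greatestPos≤ : ∀ {E n} (r : GreatestSearch E n) → greatestPos r ≤ n
greatestPos≤ (foundMax m p _ _) = p
greatestPos≤ (noneMax _) = z≤n

greatestPos-hit : ∀ {E n} (r : GreatestSearch E n) j → j ≤ n → E j → E (greatestPos r) × (j ≤ greatestPos r)
greatestPos-hit (foundMax m p e b) j j≤ ej with ℕₚ.<-cmp m j
... | tri< m<j _ _ = ⊥-elim (b j m<j j≤ ej)
... | tri≈ _ refl _ = e , ℕₚ.≤-refl
... | tri> _ _ j<m = e , ℕₚ.<⇒≤ j<m
greatestPos-hit (noneMax h) j j≤ ej = ⊥-elim (h j j≤ ej)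

greatestPos-unique : ∀ {E n} (r : GreatestSearch E n) m → m ≤ n → E m → (∀ j → m < j → j ≤ n → ¬ E j) → greatestPos r ≡ m
greatestPos-unique (foundMax m' p e b) m q e' b' with ℕₚ.<-cmp m' m
... | tri< m'<m _ _ = ⊥-elim (b m m'<m q e')
... | tri≈ _ eq _ = eq
... | tri> _ _ m<m' = ⊥-elim (b' m' m<m' p e)
greatestPos-unique (noneMax h) m q e' b' = ⊥-elim (h m q e')

greatestPos-none : ∀ {E n} (r : GreatestSearch E n) → (∀ j → j ≤ n → ¬ E j) → greatestPos r ≡ 0
greatestPos-none (foundMax m p e b) h = ⊥-elim (h m p e)
greatestPos-none (noneMax _) h = refl

-- Pattern swaps on words

-- A length- and profile-preserving bijection of all words exchanging containment of G and G'.
-- Unlike Wilf-equivalence this survives adding context (prefix-swap, suffix-swap), and on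
-- balanced words it gives a size-preserving bijection (WordSwapCount).
record WordSwap (G G' : Arch) : Set where
  field
    ψ ψ⁻ : Word → Word
    inv1 : ∀ w → ψ⁻ (ψ w) ≡ w
    inv2 : ∀ w → ψ (ψ⁻ w) ≡ w
    len : ∀ w → length (ψ w) ≡ length w
    prf : ∀ w → profile (ψ w) ≡ profile w
    to : ∀ w → Emb G (arches w) → Emb G' (arches (ψ w))
    from : ∀ w → Emb G' (arches (ψ w)) → Emb G (arches w)

  len⁻ : ∀ w → length (ψ⁻ w) ≡ length w
  len⁻ w = trans (sym (len (ψ⁻ w))) (cong length (inv2 w))
  prf⁻ : ∀ w → profile (ψ⁻ w) ≡ profile w
  prf⁻ w = trans (sym (prf (ψ⁻ w))) (cong profile (inv2 w))

-- Cut w after its shortest prefix containing P and swap the rest; the cut point does not move.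
module PrefixContext (P : Arch) where
  PrefixContains : Word → ℕ → Set
  PrefixContains w j = Emb P (arches (take j w))
  prefixContains? : ∀ w j → Dec (PrefixContains w j)
  prefixContains? w j = emb? P (arches (take j w))

  cutPos : Word → ℕ
  cutPos w = leastPos (leastSearch (PrefixContains w) (prefixContains? w) (length w))

  cutPos≤ : ∀ w → cutPos w ≤ length w
  cutPos≤ w = leastPos≤ (leastSearch (PrefixContains w) (prefixContains? w) (length w))

  cutPos-least : ∀ w j → j ≤ length w → PrefixContains w j → PrefixContains w (cutPos w) × (cutPos w ≤ j)
  cutPos-least w j = leastPos-hit (leastSearch (PrefixContains w) (prefixContains? w) (length w)) j

  cutPos-stable : ∀ w w' → length w' ≡ length w → (∀ j → j ≤ cutPos w → take j w' ≡ take j w) → cutPos w' ≡ cutPos w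
  cutPos-stable w w' el et with leastSearch (PrefixContains w) (prefixContains? w) (length w)
  ... | found m p e b = leastPos-unique (leastSearch (PrefixContains w') (prefixContains? w') (length w')) m (subst (m ≤_) (sym el) p)
                          (subst (λ z → Emb P (arches z)) (sym (et m ℕₚ.≤-refl)) e)
                          (λ j j<m e' → b j j<m (subst (λ z → Emb P (arches z)) (et j (ℕₚ.<⇒≤ j<m)) e'))
  ... | none h = trans (leastPos-none (leastSearch (PrefixContains w') (prefixContains? w') (length w'))
                          (λ j j≤ e' → h j (subst (j ≤_) el j≤) (subst (λ z → Emb P (arches z)) (et j (subst (j ≤_) el j≤)) e'))) el

  module Splice (χ : Word → Word) (χlen : ∀ v → length (χ v) ≡ length v) where
    splice : Word → Word
    splice w = take (cutPos w) w ++L χ (drop (cutPos w) w)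

    splice-length : ∀ w → length (splice w) ≡ length w
    splice-length w = trans (length-++ (take (cutPos w) w)) (trans (cong (length (take (cutPos w) w) +_) (χlen _))
               (trans (sym (length-++ (take (cutPos w) w))) (cong length (take++drop≡id (cutPos w) w))))

    splice-prefix-length : ∀ w → length (take (cutPos w) w) ≡ cutPos w
    splice-prefix-length w = length-take-≤ (cutPos w) w (cutPos≤ w)

    cutPos-splice : ∀ w → cutPos (splice w) ≡ cutPos w
    cutPos-splice w = cutPos-stable w (splice w) (splice-length w) λ j j≤ →
      trans (take-++-within (take (cutPos w) w) _ j (subst (j ≤_) (sym (splice-prefix-length w)) j≤))
            (trans (take-take j (cutPos w) w) (cong (λ z → take z w) (ℕₚ.m≤n⇒m⊓n≡m j≤)))

    take-splice : ∀ w → take (cutPos (splice w)) (splice w) ≡ take (cutPos w) w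
    take-splice w rewrite cutPos-splice w = trans (cong (λ z → take z (splice w)) (sym (splice-prefix-length w))) (take-length-++ (take (cutPos w) w) _)

    drop-splice : ∀ w → drop (cutPos (splice w)) (splice w) ≡ χ (drop (cutPos w) w)
    drop-splice w rewrite cutPos-splice w = trans (cong (λ z → drop z (splice w)) (sym (splice-prefix-length w))) (drop-length-++ (take (cutPos w) w) _)

  prefix-swap : ∀ {G G'} → WordSwap G G' → WordSwap (P ++ G) (P ++ G')
  prefix-swap {G} {G'} W = record
    { ψ = S.splice ; ψ⁻ = S⁻.splice
    ; inv1 = λ w → trans (cong₂ _++L_ (S.take-splice w) (trans (cong W.ψ⁻ (S.drop-splice w)) (W.inv1 _))) (take++drop≡id (cutPos w) w)
    ; inv2 = λ w → trans (cong₂ _++L_ (S⁻.take-splice w) (trans (cong W.ψ (S⁻.drop-splice w)) (W.inv2 _))) (take++drop≡id (cutPos w) w)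
    ; len = S.splice-length
    ; prf = λ w → trans (profile-++ (take (cutPos w) w) _) (trans (cong (profile-combine (profile (take (cutPos w) w))) (W.prf _))
                    (trans (sym (profile-++ (take (cutPos w) w) (drop (cutPos w) w))) (cong profile (take++drop≡id (cutPos w) w))))
    ; to = contains⇒ ; from = contains⇐ }
    where
    module W = WordSwap W
    module S = Splice W.ψ W.len
    module S⁻ = Splice W.ψ⁻ W.len⁻
    contains⇒ : ∀ w → Emb (P ++ G) (arches w) → Emb (P ++ G') (arches (S.splice w))
    contains⇒ w e with cut w P G e
    ... | i , i≤ , a , b with cutPos-least w i i≤ a
    ...   | eP , c≤i = uncut (S.splice w) (cutPos (S.splice w)) P G'
               (subst (λ z → Emb P (arches z)) (sym (S.take-splice w)) eP)
               (subst (λ z → Emb G' (arches z)) (sym (S.drop-splice w)) (W.to _ (emb-trans b (arches-drop-mono w (cutPos w) i c≤i))))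
    contains⇐ : ∀ w → Emb (P ++ G') (arches (S.splice w)) → Emb (P ++ G) (arches w)
    contains⇐ w e with cut (S.splice w) P G' e
    ... | i , i≤ , a , b with cutPos-least (S.splice w) i i≤ a
    ...   | eP , c≤i = uncut w (cutPos w) P G
               (subst (λ z → Emb P (arches z)) (S.take-splice w) eP)
               (W.from _ (subst (λ z → Emb G' (arches z)) (S.drop-splice w) (emb-trans b (arches-drop-mono (S.splice w) (cutPos (S.splice w)) i c≤i))))

-- Cut w before its longest suffix containing Q and swap the part before it.
module SuffixContext (Q : Arch) where
  SuffixContains : Word → ℕ → Set
  SuffixContains w j = Emb Q (arches (drop j w))
  suffixContains? : ∀ w j → Dec (SuffixContains w j)
  suffixContains? w j = emb? Q (arches (drop j w))

  suffixPos : Word → ℕ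
  suffixPos w = greatestPos (greatestSearch (SuffixContains w) (suffixContains? w) (length w))

  suffixPos≤ : ∀ w → suffixPos w ≤ length w
  suffixPos≤ w = greatestPos≤ (greatestSearch (SuffixContains w) (suffixContains? w) (length w))

  suffixPos-greatest : ∀ w j → j ≤ length w → SuffixContains w j → SuffixContains w (suffixPos w) × (j ≤ suffixPos w)
  suffixPos-greatest w j = greatestPos-hit (greatestSearch (SuffixContains w) (suffixContains? w) (length w)) j

  suffixPos-stable : ∀ w w' → length w' ≡ length w → (∀ j → suffixPos w ≤ j → drop j w' ≡ drop j w) → suffixPos w' ≡ suffixPos w
  suffixPos-stable w w' el ed with greatestSearch (SuffixContains w) (suffixContains? w) (length w)
  ... | foundMax m p e b = greatestPos-unique (greatestSearch (SuffixContains w') (suffixContains? w') (length w')) m (subst (m ≤_) (sym el) p)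
                          (subst (λ z → Emb Q (arches z)) (sym (ed m ℕₚ.≤-refl)) e)
                          (λ j m<j j≤ e' → b j m<j (subst (j ≤_) el j≤) (subst (λ z → Emb Q (arches z)) (ed j (ℕₚ.<⇒≤ m<j)) e'))
  ... | noneMax h = greatestPos-none (greatestSearch (SuffixContains w') (suffixContains? w') (length w'))
                          (λ j j≤ e' → h j (subst (j ≤_) el j≤) (subst (λ z → Emb Q (arches z)) (ed j z≤n) e'))

  module Splice (χ : Word → Word) (χlen : ∀ v → length (χ v) ≡ length v) where
    splice : Word → Word
    splice w = χ (take (suffixPos w) w) ++L drop (suffixPos w) w

    splice-prefix-length : ∀ w → length (χ (take (suffixPos w) w)) ≡ suffixPos w
    splice-prefix-length w = trans (χlen _) (length-take-≤ (suffixPos w) w (suffixPos≤ w))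

    splice-length : ∀ w → length (splice w) ≡ length w
    splice-length w = trans (length-++ (χ (take (suffixPos w) w))) (trans (cong (_+ length (drop (suffixPos w) w)) (χlen _))
               (trans (sym (length-++ (take (suffixPos w) w))) (cong length (take++drop≡id (suffixPos w) w))))

    cutPos-splice : ∀ w → suffixPos (splice w) ≡ suffixPos w
    cutPos-splice w = suffixPos-stable w (splice w) (splice-length w) λ j c≤j →
      trans (drop-++-beyond (χ (take (suffixPos w) w)) _ j (subst (_≤ j) (sym (splice-prefix-length w)) c≤j))
            (trans (cong (λ z → drop (j ∸ z) (drop (suffixPos w) w)) (splice-prefix-length w))
            (trans (drop-drop (suffixPos w) (j ∸ suffixPos w) w) (cong (λ z → drop z w) (ℕₚ.m+[n∸m]≡n c≤j))))

    take-splice : ∀ w → take (suffixPos (splice w)) (splice w) ≡ χ (take (suffixPos w) w)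
    take-splice w rewrite cutPos-splice w = trans (cong (λ z → take z (splice w)) (sym (splice-prefix-length w))) (take-length-++ (χ (take (suffixPos w) w)) _)

    drop-splice : ∀ w → drop (suffixPos (splice w)) (splice w) ≡ drop (suffixPos w) w
    drop-splice w rewrite cutPos-splice w = trans (cong (λ z → drop z (splice w)) (sym (splice-prefix-length w))) (drop-length-++ (χ (take (suffixPos w) w)) _)

  suffix-swap : ∀ {G G'} → WordSwap G G' → WordSwap (G ++ Q) (G' ++ Q)
  suffix-swap {G} {G'} W = record
    { ψ = S.splice ; ψ⁻ = S⁻.splice
    ; inv1 = λ w → trans (cong₂ _++L_ (trans (cong W.ψ⁻ (S.take-splice w)) (W.inv1 _)) (S.drop-splice w)) (take++drop≡id (suffixPos w) w)
    ; inv2 = λ w → trans (cong₂ _++L_ (trans (cong W.ψ (S⁻.take-splice w)) (W.inv2 _)) (S⁻.drop-splice w)) (take++drop≡id (suffixPos w) w)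
    ; len = S.splice-length
    ; prf = λ w → trans (profile-++ (W.ψ (take (suffixPos w) w)) _) (trans (cong (λ p → profile-combine p (profile (drop (suffixPos w) w))) (W.prf _))
                    (trans (sym (profile-++ (take (suffixPos w) w) (drop (suffixPos w) w))) (cong profile (take++drop≡id (suffixPos w) w))))
    ; to = contains⇒ ; from = contains⇐ }
    where
    module W = WordSwap W
    module S = Splice W.ψ W.len
    module S⁻ = Splice W.ψ⁻ W.len⁻
    contains⇒ : ∀ w → Emb (G ++ Q) (arches w) → Emb (G' ++ Q) (arches (S.splice w))
    contains⇒ w e with cut w G Q e
    ... | i , i≤ , a , b with suffixPos-greatest w i i≤ b
    ...   | eQ , i≤c = uncut (S.splice w) (suffixPos (S.splice w)) G' Q
               (subst (λ z → Emb G' (arches z)) (sym (S.take-splice w)) (W.to _ (emb-trans a (arches-take-mono w i (suffixPos w) i≤c))))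
               (subst (λ z → Emb Q (arches z)) (sym (S.drop-splice w)) eQ)
    contains⇐ : ∀ w → Emb (G' ++ Q) (arches (S.splice w)) → Emb (G ++ Q) (arches w)
    contains⇐ w e with cut (S.splice w) G' Q e
    ... | i , i≤ , a , b with suffixPos-greatest (S.splice w) i i≤ b
    ...   | eQ , i≤c = uncut w (suffixPos w) G Q
               (W.from _ (subst (λ z → Emb G' (arches z)) (S.take-splice w) (emb-trans a (arches-take-mono (S.splice w) i (suffixPos (S.splice w)) i≤c))))
               (subst (λ z → Emb Q (arches z)) (S.drop-splice w) eQ)

module WordSwapCount {G G' : Arch} (W : WordSwap G G') where
  module W = WordSwap W
  f g : Arch → Arch
  f C = arches (W.ψ (word C))
  g C = arches (W.ψ⁻ (word C))

  ψ-word : ∀ C → W.ψ (word C) ≡ word (f C)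
  ψ-word C = balanced⇒word _ (trans (W.prf (word C)) (profile-word C))
  ψ⁻-word : ∀ C → W.ψ⁻ (word C) ≡ word (g C)
  ψ⁻-word C = balanced⇒word _ (trans (W.prf⁻ (word C)) (profile-word C))

  gf : ∀ C → g (f C) ≡ C
  gf C = trans (cong (λ z → arches (W.ψ⁻ z)) (sym (ψ-word C))) (trans (cong arches (W.inv1 (word C))) (arches-word C))
  fg : ∀ C → f (g C) ≡ C
  fg C = trans (cong (λ z → arches (W.ψ z)) (sym (ψ⁻-word C))) (trans (cong arches (W.inv2 (word C))) (arches-word C))
  fsize : ∀ C → size (f C) ≡ size C
  fsize C = double-injective _ _ (trans (sym (length-word (f C))) (trans (cong length (sym (ψ-word C))) (trans (W.len (word C)) (length-word C))))

  contains⇒ : ∀ C → Emb G C → Emb G' (f C)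
  contains⇒ C e = W.to (word C) (subst (Emb G) (sym (arches-word C)) e)
  contains⇐ : ∀ C → Emb G' (f C) → Emb G C
  contains⇐ C e = subst (Emb G) (arches-word C) (W.from (word C) e)

  avCount≡ : ∀ n → avCount G n ≡ avCount G' n
  avCount≡ = BijectionCount.count-preserved f g gf fg fsize (avoids? G) (avoids? G') (λ C ne e → ne (contains⇐ C e)) (λ C ne e → ne (contains⇒ C e))

  gf≈ : ⟦ G ⟧A ≈ ⟦ G' ⟧A
  gf≈ n = cong ℤ.+_ (avCount≡ n)

length-render-sg : ∀ d0 ds es → length (render (sg d0 ds es)) ≡ (size (flat (sg d0 ds es)) + size (flat (sg d0 ds es))) + (length ds + length es)
length-render-sg d0 [] [] = trans (trans (cong length (++L-identityʳ (word d0))) (length-word d0))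
  (trans (cong (λ z → z + z) (sym (trans (cong size (++-identityʳ d0)) refl))) (sym (ℕₚ.+-identityʳ _)))
length-render-sg d0 (d1 ∷ ds) es =
  trans (length-++ (word d0)) (trans (cong₂ (λ x y → x + suc y) (length-word d0) (length-render-sg d1 ds es))
  (trans (arith (size d0) (size (flat (sg d1 ds es))) (length ds + length es))
         (cong (λ z → (z + z) + suc (length ds + length es)) (sym (trans (cong size (cong (d0 ++_) (++-assoc d1 (concatAll ds) (concatAll es)))) (size-++ d0 _))))))
  where
  arith : ∀ a b c → (a + a) + suc ((b + b) + c) ≡ ((a + b) + (a + b)) + suc c
  arith = solve-∀ℕ
length-render-sg d0 [] (e1 ∷ es) =
  trans (length-++ (word d0)) (trans (cong₂ (λ x y → x + suc y) (length-word d0) (length-render-sg e1 [] es))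
  (trans (arith (size d0) (size (flat (sg e1 [] es))) (length es))
         (cong (λ z → (z + z) + suc (length es)) (sym (size-++ d0 _)))))
  where
  arith : ∀ a b c → (a + a) + suc ((b + b) + (0 + c)) ≡ ((a + b) + (a + b)) + suc c
  arith = solve-∀ℕ

record SegmentSwap (G G' : Arch) : Set where
  field
    θ θ⁻ : Segment → Segment
    inv1 : ∀ s → θ⁻ (θ s) ≡ s
    inv2 : ∀ s → θ (θ⁻ s) ≡ s
    sz : ∀ s → size (flat (θ s)) ≡ size (flat s)
    lds : ∀ s → length (ds (θ s)) ≡ length (ds s)
    les : ∀ s → length (es (θ s)) ≡ length (es s)
    to : ∀ s → Emb G (flat s) → Emb G' (flat (θ s))
    from : ∀ s → Emb G' (flat (θ s)) → Emb G (flat s)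

length-render : ∀ s → length (render s) ≡ (size (flat s) + size (flat s)) + (length (ds s) + length (es s))
length-render (sg d0 ds es) = length-render-sg d0 ds es

segmentSwap⇒wordSwap : ∀ {G G'} → SegmentSwap G G' → WordSwap G G'
segmentSwap⇒wordSwap {G} {G'} S = record
  { ψ = ψ ; ψ⁻ = ψ⁻
  ; inv1 = λ w → trans (cong (λ z → render (S.θ⁻ z)) (parse-render (S.θ (parse w)))) (trans (cong render (S.inv1 (parse w))) (render-parse w))
  ; inv2 = λ w → trans (cong (λ z → render (S.θ z)) (parse-render (S.θ⁻ (parse w)))) (trans (cong render (S.inv2 (parse w))) (render-parse w))
  ; len = λ w → trans (length-render (S.θ (parse w))) (trans (cong₂ (λ x y → (x + x) + y) (S.sz (parse w)) (cong₂ _+_ (S.lds (parse w)) (S.les (parse w))))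
                  (trans (sym (length-render (parse w))) (cong length (render-parse w))))
  ; prf = λ w → trans (cong (λ z → length (ds z) , length (es z)) (parse-render (S.θ (parse w)))) (cong₂ _,_ (S.lds (parse w)) (S.les (parse w)))
  ; to = λ w e → subst (λ z → Emb G' (flat z)) (sym (parse-render (S.θ (parse w)))) (S.to (parse w) e)
  ; from = λ w e → S.from (parse w) (subst (λ z → Emb G' (flat z)) (parse-render (S.θ (parse w))) e) }
  where
  module S = SegmentSwap S
  ψ ψ⁻ : Word → Word
  ψ w = render (S.θ (parse w))
  ψ⁻ w = render (S.θ⁻ (parse w))

mapAtoms : (Arch → Arch) → Arch → Arch
mapAtoms h ε = ε
mapAtoms h (⟨ C ⟩∷ R) = ⟨ h C ⟩∷ mapAtoms h R

mapAtoms-++ : ∀ h X Y → mapAtoms h (X ++ Y) ≡ mapAtoms h X ++ mapAtoms h Y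
mapAtoms-++ h ε Y = refl
mapAtoms-++ h (⟨ C ⟩∷ R) Y = cong (⟨ h C ⟩∷_) (mapAtoms-++ h R Y)

mapAtoms-inverse : ∀ h h' → (∀ C → h' (h C) ≡ C) → ∀ X → mapAtoms h' (mapAtoms h X) ≡ X
mapAtoms-inverse h h' e ε = refl
mapAtoms-inverse h h' e (⟨ C ⟩∷ R) = cong₂ ⟨_⟩∷_ (e C) (mapAtoms-inverse h h' e R)

mapAtoms-size : ∀ h → (∀ C → size (h C) ≡ size C) → ∀ X → size (mapAtoms h X) ≡ size X
mapAtoms-size h e ε = refl
mapAtoms-size h e (⟨ C ⟩∷ R) = cong suc (cong₂ _+_ (e C) (mapAtoms-size h e R))

concatAll-map : ∀ h xs → concatAll (map (mapAtoms h) xs) ≡ mapAtoms h (concatAll xs)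
concatAll-map h [] = refl
concatAll-map h (x ∷ xs) = trans (cong (mapAtoms h x ++_) (concatAll-map h xs)) (sym (mapAtoms-++ h x (concatAll xs)))

mapSegment : (Arch → Arch) → Segment → Segment
mapSegment h (sg d0 ds es) = sg (mapAtoms h d0) (map (mapAtoms h) ds) (map (mapAtoms h) es)

flat-mapSegment : ∀ h s → flat (mapSegment h s) ≡ mapAtoms h (flat s)
flat-mapSegment h (sg d0 ds es) = trans (cong (mapAtoms h d0 ++_) (cong₂ _++_ (concatAll-map h ds) (concatAll-map h es)))
  (trans (cong (mapAtoms h d0 ++_) (sym (mapAtoms-++ h (concatAll ds) (concatAll es)))) (sym (mapAtoms-++ h d0 _)))

map-inverse : ∀ {X : Set} (h h' : X → X) → (∀ x → h' (h x) ≡ x) → ∀ xs → map h' (map h xs) ≡ xs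
map-inverse h h' e [] = refl
map-inverse h h' e (x ∷ xs) = cong₂ _∷_ (e x) (map-inverse h h' e xs)

-- ⟨ A ⟩ occurs in an arch system iff A occurs inside one of its top-level atoms, so
-- applying τ inside every top-level atom turns ⟨ A ⟩-containment into ⟨ B ⟩-containment.
module AtomSwap (A B : Arch) (τ τ⁻ : Arch → Arch) (τinv1 : ∀ C → τ⁻ (τ C) ≡ C) (τinv2 : ∀ C → τ (τ⁻ C) ≡ C)
               (τsize : ∀ C → size (τ C) ≡ size C) (τto : ∀ C → Emb A C → Emb B (τ C)) (τfrom : ∀ C → Emb B (τ C) → Emb A C) where

  contains⇒ : ∀ F → Emb (⟨ A ⟩∷ ε) F → Emb (⟨ B ⟩∷ ε) (mapAtoms τ F)
  contains⇒ ε ()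
  contains⇒ (⟨ C ⟩∷ R) e with emb-atom⁻ A C R e
  ... | inj₁ e1 = emb-atom⁺ B (τ C) (mapAtoms τ R) (inj₁ (τto C e1))
  ... | inj₂ e2 = emb-atom⁺ B (τ C) (mapAtoms τ R) (inj₂ (contains⇒ R e2))

  contains⇐ : ∀ F → Emb (⟨ B ⟩∷ ε) (mapAtoms τ F) → Emb (⟨ A ⟩∷ ε) F
  contains⇐ ε ()
  contains⇐ (⟨ C ⟩∷ R) e with emb-atom⁻ B (τ C) (mapAtoms τ R) e
  ... | inj₁ e1 = emb-atom⁺ A C R (inj₁ (τfrom C e1))
  ... | inj₂ e2 = emb-atom⁺ A C R (inj₂ (contains⇐ R e2))

  swap : SegmentSwap (⟨ A ⟩∷ ε) (⟨ B ⟩∷ ε)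
  swap = record
    { θ = mapSegment τ ; θ⁻ = mapSegment τ⁻
    ; inv1 = λ { (sg d0 ds es) → cong₃ sg (mapAtoms-inverse τ τ⁻ τinv1 d0) (map-inverse _ _ (mapAtoms-inverse τ τ⁻ τinv1) ds) (map-inverse _ _ (mapAtoms-inverse τ τ⁻ τinv1) es) }
    ; inv2 = λ { (sg d0 ds es) → cong₃ sg (mapAtoms-inverse τ⁻ τ τinv2 d0) (map-inverse _ _ (mapAtoms-inverse τ⁻ τ τinv2) ds) (map-inverse _ _ (mapAtoms-inverse τ⁻ τ τinv2) es) }
    ; sz = λ s → trans (cong size (flat-mapSegment τ s)) (mapAtoms-size τ τsize (flat s))
    ; lds = λ { (sg d0 ds es) → length-map _ ds }
    ; les = λ { (sg d0 ds es) → length-map _ es }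
    ; to = λ s e → subst (Emb (⟨ B ⟩∷ ε)) (sym (flat-mapSegment τ s)) (contains⇒ (flat s) e)
    ; from = λ s e → contains⇐ (flat s) (subst (Emb (⟨ B ⟩∷ ε)) (flat-mapSegment τ s) e) }
    where
    cong₃ : ∀ {a b c a' b' c'} (f : Arch → List Arch → List Arch → Segment) → a ≡ a' → b ≡ b' → c ≡ c' → f a b c ≡ f a' b' c'
    cong₃ f refl refl refl = refl

contents : Arch → List Arch
contents ε = []
contents (⟨ C ⟩∷ R) = C ∷ contents R

assemble : List Arch → Arch
assemble [] = ε
assemble (C ∷ ts) = ⟨ C ⟩∷ assemble ts

assemble-contents : ∀ X → assemble (contents X) ≡ X
assemble-contents ε = refl
assemble-contents (⟨ C ⟩∷ R) = cong (⟨ C ⟩∷_) (assemble-contents R)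

contents-assemble : ∀ ts → contents (assemble ts) ≡ ts
contents-assemble [] = refl
contents-assemble (C ∷ ts) = cong (C ∷_) (contents-assemble ts)

assemble-++L : ∀ xs ys → assemble (xs ++L ys) ≡ assemble xs ++ assemble ys
assemble-++L [] ys = refl
assemble-++L (x ∷ xs) ys = cong (⟨ x ⟩∷_) (assemble-++L xs ys)

contents-++ : ∀ X Y → contents (X ++ Y) ≡ contents X ++L contents Y
contents-++ ε Y = refl
contents-++ (⟨ C ⟩∷ R) Y = cong (C ∷_) (contents-++ R Y)

-- Cut ts into consecutive blocks of lengths n0, ns and ms and assemble the blocks into a segment.
reshape : ℕ → List ℕ → List ℕ → List Arch → Segment
reshape n0 [] [] ts = sg (assemble (take n0 ts)) [] []
reshape n0 (n1 ∷ ns) ms ts = sg (assemble (take n0 ts)) (d0 (reshape n1 ns ms (drop n0 ts)) ∷ ds (reshape n1 ns ms (drop n0 ts))) (es (reshape n1 ns ms (drop n0 ts)))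
reshape n0 [] (m1 ∷ ms) ts = sg (assemble (take n0 ts)) [] (d0 (reshape m1 [] ms (drop n0 ts)) ∷ es (reshape m1 [] ms (drop n0 ts)))

width : Arch → ℕ
width X = length (contents X)

total : ℕ → List ℕ → List ℕ → ℕ
total n0 ns ms = n0 + (sum ns + sum ms)

segmentContents : Segment → List Arch
segmentContents s = contents (flat s)

take-contents : ∀ d X → take (width d) (contents (d ++ X)) ≡ contents d
take-contents d X = trans (cong (take (width d)) (contents-++ d X)) (take-length-++ (contents d) (contents X))

drop-contents : ∀ d X → drop (width d) (contents (d ++ X)) ≡ contents X
drop-contents d X = trans (cong (drop (width d)) (contents-++ d X)) (drop-length-++ (contents d) (contents X))

reshape-segment : ∀ d0 ds es → reshape (width d0) (map width ds) (map width es) (segmentContents (sg d0 ds es)) ≡ sg d0 ds es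
reshape-segment d0 [] [] = cong (λ z → sg z [] []) (trans (cong assemble (take-contents d0 ε)) (assemble-contents d0))
reshape-segment d0 (d1 ∷ ds) es
  rewrite take-contents d0 ((d1 ++ concatAll ds) ++ concatAll es) | drop-contents d0 ((d1 ++ concatAll ds) ++ concatAll es)
        | ++-assoc d1 (concatAll ds) (concatAll es) | reshape-segment d1 ds es | assemble-contents d0 = refl
reshape-segment d0 [] (e1 ∷ es)
  rewrite take-contents d0 (e1 ++ concatAll es) | drop-contents d0 (e1 ++ concatAll es) | reshape-segment e1 [] es | assemble-contents d0 = refl

reshape-d0 : ∀ n0 ns ms ts → n0 ≤ length ts → width (d0 (reshape n0 ns ms ts)) ≡ n0
reshape-d0 n0 [] [] ts p = trans (cong length (contents-assemble (take n0 ts))) (length-take-≤ n0 ts p)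
reshape-d0 n0 (n1 ∷ ns) ms ts p = trans (cong length (contents-assemble (take n0 ts))) (length-take-≤ n0 ts p)
reshape-d0 n0 [] (m1 ∷ ms) ts p = trans (cong length (contents-assemble (take n0 ts))) (length-take-≤ n0 ts p)

reshape-ds : ∀ n0 ns ms ts → length ts ≡ total n0 ns ms → map width (ds (reshape n0 ns ms ts)) ≡ ns
reshape-ds n0 [] [] ts e = refl
reshape-ds n0 (n1 ∷ ns) ms ts e =
  cong₂ _∷_ (reshape-d0 n1 ns ms (drop n0 ts) (≤-length n1 (drop n0 ts) _ lenEq)) (reshape-ds n1 ns ms (drop n0 ts) lenEq)
  where
  lenEq : length (drop n0 ts) ≡ total n1 ns ms
  lenEq = length-drop-+ n0 ts _ (trans e (cong (n0 +_) (ℕₚ.+-assoc n1 (sum ns) (sum ms))))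
reshape-ds n0 [] (m1 ∷ ms) ts e = refl

reshape-es : ∀ n0 ns ms ts → length ts ≡ total n0 ns ms → map width (es (reshape n0 ns ms ts)) ≡ ms
reshape-es n0 [] [] ts e = refl
reshape-es n0 (n1 ∷ ns) ms ts e = reshape-es n1 ns ms (drop n0 ts) (length-drop-+ n0 ts _ (trans e (cong (n0 +_) (ℕₚ.+-assoc n1 (sum ns) (sum ms)))))
reshape-es n0 [] (m1 ∷ ms) ts e =
  cong₂ _∷_ (reshape-d0 m1 [] ms (drop n0 ts) (≤-length m1 (drop n0 ts) _ lenEq)) (reshape-es m1 [] ms (drop n0 ts) lenEq)
  where
  lenEq : length (drop n0 ts) ≡ total m1 [] ms
  lenEq = length-drop-+ n0 ts _ e

reshape-flat : ∀ n0 ns ms ts → length ts ≡ total n0 ns ms → flat (reshape n0 ns ms ts) ≡ assemble ts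
reshape-flat n0 [] [] ts e = trans (++-identityʳ _) (cong assemble (take-all n0 ts (ℕₚ.≤-reflexive (trans e (ℕₚ.+-identityʳ n0)))))
reshape-flat n0 (n1 ∷ ns) ms ts e =
  trans (cong (assemble (take n0 ts) ++_) (++-assoc (d0 r) (concatAll (ds r)) (concatAll (es r))))
  (trans (cong (assemble (take n0 ts) ++_) (reshape-flat n1 ns ms (drop n0 ts) lenEq))
  (trans (sym (assemble-++L (take n0 ts) (drop n0 ts))) (cong assemble (take++drop≡id n0 ts))))
  where
  lenEq : length (drop n0 ts) ≡ total n1 ns ms
  lenEq = length-drop-+ n0 ts _ (trans e (cong (n0 +_) (ℕₚ.+-assoc n1 (sum ns) (sum ms))))
  r = reshape n1 ns ms (drop n0 ts)
reshape-flat n0 [] (m1 ∷ ms) ts e =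
  trans (cong (λ z → assemble (take n0 ts) ++ (d0 r ++ (concatAll z ++ concatAll (es r)))) (sym dsnil))
  (trans (cong (assemble (take n0 ts) ++_) (reshape-flat m1 [] ms (drop n0 ts) lenEq))
  (trans (sym (assemble-++L (take n0 ts) (drop n0 ts))) (cong assemble (take++drop≡id n0 ts))))
  where
  lenEq : length (drop n0 ts) ≡ total m1 [] ms
  lenEq = length-drop-+ n0 ts _ e
  r = reshape m1 [] ms (drop n0 ts)
  dsnil : ds r ≡ []
  dsnil = map≡[] width (ds r) (reshape-ds m1 [] ms (drop n0 ts) lenEq)

length-contents-concatAll : ∀ xs → length (contents (concatAll xs)) ≡ sum (map width xs)
length-contents-concatAll [] = refl
length-contents-concatAll (x ∷ xs) = trans (cong length (contents-++ x (concatAll xs))) (trans (length-++ (contents x)) (cong (width x +_) (length-contents-concatAll xs)))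

reshapeAs : Segment → List Arch → Segment
reshapeAs s = reshape (width (d0 s)) (map width (ds s)) (map width (es s))

segmentWidth : Segment → ℕ
segmentWidth s = total (width (d0 s)) (map width (ds s)) (map width (es s))

total-segmentContents : ∀ s → length (segmentContents s) ≡ segmentWidth s
total-segmentContents (sg d0 ds es) = trans (cong length (contents-++ d0 _)) (trans (length-++ (contents d0))
   (cong (width d0 +_) (trans (cong length (contents-++ (concatAll ds) (concatAll es))) (trans (length-++ (contents (concatAll ds))) (cong₂ _+_ (length-contents-concatAll ds) (length-contents-concatAll es))))))

pair : Arch → Arch → Arch
pair X Y = ⟨ X ⟩∷ ⟨ Y ⟩∷ ε

emb-atom-assemble⁻ : ∀ Y ts → Emb (⟨ Y ⟩∷ ε) (assemble ts) → Any (Emb Y) ts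
emb-atom-assemble⁻ Y [] ()
emb-atom-assemble⁻ Y (C ∷ ts) e with emb-atom⁻ Y C (assemble ts) e
... | inj₁ e1 = here e1
... | inj₂ e2 = there (emb-atom-assemble⁻ Y ts e2)

emb-atom-assemble⁺ : ∀ Y ts → Any (Emb Y) ts → Emb (⟨ Y ⟩∷ ε) (assemble ts)
emb-atom-assemble⁺ Y (C ∷ ts) (here e) = emb-atom⁺ Y C (assemble ts) (inj₁ e)
emb-atom-assemble⁺ Y (C ∷ ts) (there a) = emb-atom⁺ Y C (assemble ts) (inj₂ (emb-atom-assemble⁺ Y ts a))

PairSplit : Arch → Arch → List Arch → Set
PairSplit X Y ts = Σ (List Arch) λ ts1 → Σ (List Arch) λ ts2 → (ts ≡ ts1 ++L ts2) × Any (Emb X) ts1 × Any (Emb Y) ts2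

PairOccurrence : Arch → Arch → List Arch → Set
PairOccurrence X Y ts = PairSplit X Y ts ⊎ Any (Emb (pair X Y)) ts

emb-pair⁻ : ∀ X Y ts → Emb (pair X Y) (assemble ts) → PairOccurrence X Y ts
emb-pair⁻ X Y [] ()
emb-pair⁻ X Y (C ∷ ts) e with emb-atom∷⁻ X (⟨ Y ⟩∷ ε) C (assemble ts) (atom Y) e
... | inj₁ (e1 , e2) = inj₁ (C ∷ [] , ts , refl , here e1 , emb-atom-assemble⁻ Y ts e2)
... | inj₂ (inj₂ e3) = inj₂ (here e3)
... | inj₂ (inj₁ e2) with emb-pair⁻ X Y ts e2
...   | inj₁ (ts1 , ts2 , refl , a , b) = inj₁ (C ∷ ts1 , ts2 , refl , there a , b)
...   | inj₂ a = inj₂ (there a)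

emb-pair-split⁺ : ∀ X Y ts1 ts2 → Any (Emb X) ts1 → Any (Emb Y) ts2 → Emb (pair X Y) (assemble (ts1 ++L ts2))
emb-pair-split⁺ X Y (C ∷ ts1) ts2 (here e) b = emb-atom∷⁺ X (⟨ Y ⟩∷ ε) C (assemble (ts1 ++L ts2)) (inj₁ (e , emb-atom-assemble⁺ Y (ts1 ++L ts2) (AnyP.++⁺ʳ ts1 b)))
emb-pair-split⁺ X Y (C ∷ ts1) ts2 (there a) b = emb-atom∷⁺ X (⟨ Y ⟩∷ ε) C (assemble (ts1 ++L ts2)) (inj₂ (inj₁ (emb-pair-split⁺ X Y ts1 ts2 a b)))

emb-pair-inside⁺ : ∀ X Y ts → Any (Emb (pair X Y)) ts → Emb (pair X Y) (assemble ts)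
emb-pair-inside⁺ X Y (C ∷ ts) (here e) = emb-atom∷⁺ X (⟨ Y ⟩∷ ε) C (assemble ts) (inj₂ (inj₂ e))
emb-pair-inside⁺ X Y (C ∷ ts) (there a) = emb-atom∷⁺ X (⟨ Y ⟩∷ ε) C (assemble ts) (inj₂ (inj₁ (emb-pair-inside⁺ X Y ts a)))

emb-pair⁺ : ∀ X Y ts → PairOccurrence X Y ts → Emb (pair X Y) (assemble ts)
emb-pair⁺ X Y ts (inj₁ (ts1 , ts2 , refl , a , b)) = emb-pair-split⁺ X Y ts1 ts2 a b
emb-pair⁺ X Y ts (inj₂ a) = emb-pair-inside⁺ X Y ts a

size-assemble-++L : ∀ xs ys → size (assemble (xs ++L ys)) ≡ size (assemble xs) + size (assemble ys)
size-assemble-++L xs ys = trans (cong size (assemble-++L xs ys)) (size-++ (assemble xs) (assemble ys))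

size-assemble-reverse : ∀ xs → size (assemble (reverse xs)) ≡ size (assemble xs)
size-assemble-reverse [] = refl
size-assemble-reverse (x ∷ xs) = trans (cong (λ z → size (assemble z)) (unfold-reverse x xs))
  (trans (size-assemble-++L (reverse xs) (x ∷ []))
  (trans (cong (_+ suc (size x + 0)) (size-assemble-reverse xs))
  (trans (ℕₚ.+-comm (size (assemble xs)) _) (cong suc (trans (cong (_+ size (assemble xs)) (ℕₚ.+-identityʳ (size x))) refl)))))

size-assemble-map : ∀ (h : Arch → Arch) → (∀ C → size (h C) ≡ size C) → ∀ xs → size (assemble (map h xs)) ≡ size (assemble xs)
size-assemble-map h e [] = refl
size-assemble-map h e (x ∷ xs) = cong suc (cong₂ _+_ (e x) (size-assemble-map h e xs))

-- ⟨ A ⟩ ⟨ B ⟩ occurs in a sequence of atoms iff it occurs inside one of them or an A-atom precedes a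
-- B-atom. Reversing the sequence of all top-level atoms of a parsed word, applying σ inside each, and
-- reshaping to the old widths therefore exchanges ⟨ A ⟩ ⟨ B ⟩ with ⟨ B ⟩ ⟨ A ⟩.
module ReverseSwap (A B : Arch) (σ σ⁻ : Arch → Arch) (σinv1 : ∀ C → σ⁻ (σ C) ≡ C) (σinv2 : ∀ C → σ (σ⁻ C) ≡ C)
               (σsize : ∀ C → size (σ C) ≡ size C)
               (σA : ∀ C → Emb A C → Emb A (σ C)) (σA' : ∀ C → Emb A (σ C) → Emb A C)
               (σB : ∀ C → Emb B C → Emb B (σ C)) (σB' : ∀ C → Emb B (σ C) → Emb B C)
               (σab : ∀ C → Emb (pair A B) C → Emb (pair B A) (σ C)) (σba : ∀ C → Emb (pair B A) (σ C) → Emb (pair A B) C) where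

  σ⁻A : ∀ C → Emb A C → Emb A (σ⁻ C)
  σ⁻A C e = σA' (σ⁻ C) (subst (Emb A) (sym (σinv2 C)) e)
  σ⁻B : ∀ C → Emb B C → Emb B (σ⁻ C)
  σ⁻B C e = σB' (σ⁻ C) (subst (Emb B) (sym (σinv2 C)) e)

  pair-occurrence⇒ : ∀ ts → PairOccurrence A B ts → PairOccurrence B A (reverse (map σ ts))
  pair-occurrence⇒ ts (inj₁ (ts1 , ts2 , refl , a , b)) =
    inj₁ (reverse (map σ ts2) , reverse (map σ ts1) , trans (cong reverse (map-++ σ ts1 ts2)) (reverse-++ (map σ ts1) (map σ ts2)) ,
          AnyP.reverse⁺ (any-map⁺ σ σB b) , AnyP.reverse⁺ (any-map⁺ σ σA a))
  pair-occurrence⇒ ts (inj₂ a) = inj₂ (AnyP.reverse⁺ (any-map⁺ σ σab a))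

  pair-occurrence⇐ : ∀ ts → PairOccurrence B A (reverse (map σ ts)) → PairOccurrence A B ts
  pair-occurrence⇐ ts (inj₁ (us1 , us2 , eq , b , a)) =
    inj₁ (map σ⁻ (reverse us2) , map σ⁻ (reverse us1) , eqT , any-map⁺ σ⁻ σ⁻A (AnyP.reverse⁺ a) , any-map⁺ σ⁻ σ⁻B (AnyP.reverse⁺ b))
    where
    eqT : ts ≡ map σ⁻ (reverse us2) ++L map σ⁻ (reverse us1)
    eqT = trans (sym (map-inverse σ σ⁻ σinv1 ts))
          (trans (cong (map σ⁻) (trans (sym (reverse-involutive (map σ ts))) (trans (cong reverse eq) (reverse-++ us1 us2))))
                 (map-++ σ⁻ (reverse us2) (reverse us1)))
  pair-occurrence⇐ ts (inj₂ a) = inj₂ (Any.map (λ {x} → σba x) (AnyP.map⁻ (AnyP.reverse⁻ a)))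

  θ θ⁻ : Segment → Segment
  θ s = reshapeAs s (reverse (map σ (segmentContents s)))
  θ⁻ s = reshapeAs s (map σ⁻ (reverse (segmentContents s)))

  length-θ-input : ∀ s → length (reverse (map σ (segmentContents s))) ≡ segmentWidth s
  length-θ-input s = trans (length-reverse (map σ (segmentContents s))) (trans (length-map σ (segmentContents s)) (total-segmentContents s))
  length-θ⁻-input : ∀ s → length (map σ⁻ (reverse (segmentContents s))) ≡ segmentWidth s
  length-θ⁻-input s = trans (length-map σ⁻ (reverse (segmentContents s))) (trans (length-reverse (segmentContents s)) (total-segmentContents s))

  reshape-cong : ∀ {a a' b b' c c' d d'} → a ≡ a' → b ≡ b' → c ≡ c' → d ≡ d' → reshape a b c d ≡ reshape a' b' c' d'
  reshape-cong refl refl refl refl = refl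

  module Reshaped (s : Segment) (ts : List Arch) (lenEq : length ts ≡ segmentWidth s) where
    r = reshapeAs s ts
    flat-reshaped : flat r ≡ assemble ts
    flat-reshaped = reshape-flat (width (d0 s)) (map width (ds s)) (map width (es s)) ts lenEq
    contents-reshaped : segmentContents r ≡ ts
    contents-reshaped = trans (cong contents flat-reshaped) (contents-assemble ts)
    width-d0-reshaped : width (d0 r) ≡ width (d0 s)
    width-d0-reshaped = reshape-d0 (width (d0 s)) (map width (ds s)) (map width (es s)) ts (≤-length (width (d0 s)) ts _ lenEq)
    widths-ds-reshaped : map width (ds r) ≡ map width (ds s)
    widths-ds-reshaped = reshape-ds (width (d0 s)) (map width (ds s)) (map width (es s)) ts lenEq
    widths-es-reshaped : map width (es r) ≡ map width (es s)
    widths-es-reshaped = reshape-es (width (d0 s)) (map width (ds s)) (map width (es s)) ts lenEq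

  reshape-self : ∀ s → reshapeAs s (segmentContents s) ≡ s
  reshape-self (sg d0 ds es) = reshape-segment d0 ds es

  inv1 : ∀ s → θ⁻ (θ s) ≡ s
  inv1 s = trans (reshape-cong width-d0-reshaped widths-ds-reshaped widths-es-reshaped (trans (cong (λ z → map σ⁻ (reverse z)) contents-reshaped)
                    (trans (cong (map σ⁻) (reverse-involutive (map σ (segmentContents s)))) (map-inverse σ σ⁻ σinv1 (segmentContents s)))))
                 (reshape-self s)
    where open Reshaped s (reverse (map σ (segmentContents s))) (length-θ-input s)

  inv2 : ∀ s → θ (θ⁻ s) ≡ s
  inv2 s = trans (reshape-cong width-d0-reshaped widths-ds-reshaped widths-es-reshaped (trans (cong (λ z → reverse (map σ z)) contents-reshaped)
                    (trans (cong reverse (map-inverse σ⁻ σ σinv2 (reverse (segmentContents s)))) (reverse-involutive (segmentContents s)))))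
                 (reshape-self s)
    where open Reshaped s (map σ⁻ (reverse (segmentContents s))) (length-θ⁻-input s)

  assemble-segmentContents : ∀ s → assemble (segmentContents s) ≡ flat s
  assemble-segmentContents s = assemble-contents (flat s)

  swap : SegmentSwap (pair A B) (pair B A)
  swap = record
    { θ = θ ; θ⁻ = θ⁻ ; inv1 = inv1 ; inv2 = inv2
    ; sz = λ s → trans (cong size (Reshaped.flat-reshaped s _ (length-θ-input s))) (trans (size-assemble-reverse (map σ (segmentContents s))) (trans (size-assemble-map σ σsize (segmentContents s)) (cong size (assemble-segmentContents s))))
    ; lds = λ s → trans (sym (length-map width (ds (θ s)))) (trans (cong length (Reshaped.widths-ds-reshaped s _ (length-θ-input s))) (length-map width (ds s)))
    ; les = λ s → trans (sym (length-map width (es (θ s)))) (trans (cong length (Reshaped.widths-es-reshaped s _ (length-θ-input s))) (length-map width (es s)))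
    ; to = λ s e → subst (Emb (pair B A)) (sym (Reshaped.flat-reshaped s _ (length-θ-input s)))
                     (emb-pair⁺ B A _ (pair-occurrence⇒ (segmentContents s) (emb-pair⁻ A B (segmentContents s) (subst (Emb (pair A B)) (sym (assemble-segmentContents s)) e))))
    ; from = λ s e → subst (Emb (pair A B)) (assemble-segmentContents s)
                     (emb-pair⁺ A B (segmentContents s) (pair-occurrence⇐ (segmentContents s) (emb-pair⁻ B A _ (subst (Emb (pair B A)) (Reshaped.flat-reshaped s _ (length-θ-input s)) e)))) }

-- Base cases of the swaps

containsᵇ : Arch → Arch → Bool
containsᵇ P C = does (emb? P C)

containsᵇ-true⁻ : ∀ P C → containsᵇ P C ≡ true → Emb P C
containsᵇ-true⁻ P C e with emb? P C
... | yes p = p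
containsᵇ-false⁻ : ∀ P C → containsᵇ P C ≡ false → ¬ Emb P C
containsᵇ-false⁻ P C e with emb? P C
... | no np = np
containsᵇ-true⁺ : ∀ P C → Emb P C → containsᵇ P C ≡ true
containsᵇ-true⁺ P C p with emb? P C
... | yes _ = refl
... | no np = ⊥-elim (np p)
containsᵇ-false⁺ : ∀ P C → ¬ Emb P C → containsᵇ P C ≡ false
containsᵇ-false⁺ P C np with emb? P C
... | yes p = ⊥-elim (np p)
... | no _ = refl

containsᵇ-transfer : ∀ P Q {C D} → containsᵇ Q D ≡ containsᵇ P C → Emb P C → Emb Q D
containsᵇ-transfer P Q {C} {D} e c = containsᵇ-true⁻ Q D (trans e (containsᵇ-true⁺ P C c))

avCount≡⇒containCount≡ : ∀ A B → (∀ n → avCount A n ≡ avCount B n) → ∀ n → count (emb? A) (enum n) ≡ count (emb? B) (enum n)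
avCount≡⇒containCount≡ A B h n = ℕₚ.+-cancelʳ-≡ _ (count (emb? A) (enum n)) (count (emb? B) (enum n))
  (trans (count-∁ (emb? A) (enum n)) (trans (sym (count-∁ (emb? B) (enum n))) (cong (count (emb? B) (enum n) +_) (sym (h n)))))

containment-bijection : ∀ A B → (∀ n → avCount A n ≡ avCount B n) → ClassBijection (containsᵇ A) (containsᵇ B)
containment-bijection A B h = ClassBijectionFromCounts.classBijection Bool._≟_ (containsᵇ A) (containsᵇ B) hyp
  where
  hyp : ∀ c n → count (λ C → containsᵇ A C Bool.≟ c) (enum n) ≡ count (λ C → containsᵇ B C Bool.≟ c) (enum n)
  hyp false n = trans (count-cong _ (avoids? A) (containsᵇ-false⁻ A) (containsᵇ-false⁺ A) (enum n))
                (trans (h n) (sym (count-cong _ (avoids? B) (containsᵇ-false⁻ B) (containsᵇ-false⁺ B) (enum n))))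
  hyp true n = trans (count-cong _ (emb? A) (containsᵇ-true⁻ A) (containsᵇ-true⁺ A) (enum n))
               (trans (avCount≡⇒containCount≡ A B h n) (sym (count-cong _ (emb? B) (containsᵇ-true⁻ B) (containsᵇ-true⁺ B) (enum n))))

atom-swap : ∀ A B → (∀ n → avCount A n ≡ avCount B n) → WordSwap (⟨ A ⟩∷ ε) (⟨ B ⟩∷ ε)
atom-swap A B h = segmentSwap⇒wordSwap (AtomSwap.swap A B T.f T.g T.gf T.fg T.fsize
   (λ C → containsᵇ-transfer A B (T.fclass C)) (λ C → containsᵇ-transfer B A (sym (T.fclass C))))
  where module T = ClassBijection (containment-bijection A B h)

,,-injective : ∀ {a b c x y z : Bool} → (a , b , c) ≡ (x , y , z) → (a ≡ x) × (b ≡ y) × (c ≡ z)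
,,-injective refl = refl , refl , refl
,,-cong : ∀ {a b c x y z : Bool} → a ≡ x → b ≡ y → c ≡ z → (a , b , c) ≡ (x , y , z)
,,-cong refl refl refl = refl

pair⇒first : ∀ {X Y C} → Emb (pair X Y) C → Emb X C
pair⇒first {X} {Y} e = emb-trans (emb-content X (⟨ Y ⟩∷ ε)) e
pair⇒second : ∀ {X Y C} → Emb (pair X Y) C → Emb Y C
pair⇒second {X} {Y} e = emb-trans (emb-trans (emb-content Y ε) (emb-tail X (⟨ Y ⟩∷ ε))) e

-- Classify arch systems by whether they contain A, B and the pair. Containing a pair forces
-- containing A and B, so h fixes the class counts that differ between the two classifications.
module PairClasses (A B : Arch) (h : ∀ n → avCount (pair A B) n ≡ avCount (pair B A) n) where
  K = Bool × Bool × Bool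
  _≟K_ : DecidableEquality K
  _≟K_ = ≡-dec Bool._≟_ (≡-dec Bool._≟_ Bool._≟_)

  classOf : Arch → Arch → K
  classOf P C = containsᵇ A C , containsᵇ B C , containsᵇ P C

  classCount : Arch → K → ℕ → ℕ
  classCount P c n = count (λ C → classOf P C ≟K c) (enum n)

  AB⇒A,B : ∀ {C} → Emb (pair A B) C → Emb A C × Emb B C
  AB⇒A,B p = pair⇒first p , pair⇒second p
  BA⇒A,B : ∀ {C} → Emb (pair B A) C → Emb A C × Emb B C
  BA⇒A,B p = pair⇒second p , pair⇒first p

  -- Classes with (x , y) ≠ (true , true) contain neither pair.
  module NotBoth (x y : Bool) (ne : x ≡ true → y ≡ true → ⊥) where
    neither : ∀ {P C} → (Emb P C → Emb A C × Emb B C) → containsᵇ A C ≡ x → containsᵇ B C ≡ y → ¬ Emb P C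
    neither {C = C} inAB a b p = ne (trans (sym a) (containsᵇ-true⁺ A C (proj₁ (inAB p)))) (trans (sym b) (containsᵇ-true⁺ B C (proj₂ (inAB p))))

    excluded : ∀ {P C} → (Emb P C → Emb A C × Emb B C) → ¬ (classOf P C ≡ (x , y , true))
    excluded {P} {C} inAB e with ,,-injective e
    ... | a , b , c = neither inAB a b (containsᵇ-true⁻ P C c)

    noPair-containsPair : ∀ n → classCount (pair A B) (x , y , true) n ≡ classCount (pair B A) (x , y , true) n
    noPair-containsPair n = trans (count-none _ (enum n) (λ C → excluded AB⇒A,B)) (sym (count-none _ (enum n) (λ C → excluded BA⇒A,B)))

    noPair-avoidsPair : ∀ n → classCount (pair A B) (x , y , false) n ≡ classCount (pair B A) (x , y , false) n
    noPair-avoidsPair n = count-via _ _ ((λ C → containsᵇ A C Bool.≟ x) ∩? (λ C → containsᵇ B C Bool.≟ y))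
      (λ C e → let (a , b , c) = ,,-injective e in a , b)
      (λ C (a , b) → ,,-cong a b (containsᵇ-false⁺ _ C (neither AB⇒A,B a b)))
      (λ C e → let (a , b , c) = ,,-injective e in a , b)
      (λ C (a , b) → ,,-cong a b (containsᵇ-false⁺ _ C (neither BA⇒A,B a b)))
      (enum n)

  pairContainCount≡ : ∀ n → count (emb? (pair A B)) (enum n) ≡ count (emb? (pair B A)) (enum n)
  pairContainCount≡ = avCount≡⇒containCount≡ (pair A B) (pair B A) h

  containsPair-count : ∀ P → (∀ {C} → Emb P C → Emb A C × Emb B C) → ∀ n → classCount P (true , true , true) n ≡ count (emb? P) (enum n)
  containsPair-count P inAB n = count-cong _ (emb? P) (λ C e → containsᵇ-true⁻ P C (proj₂ (proj₂ (,,-injective e))))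
    (λ C p → ,,-cong (containsᵇ-true⁺ A C (proj₁ (inAB p))) (containsᵇ-true⁺ B C (proj₂ (inAB p))) (containsᵇ-true⁺ P C p)) (enum n)

  containsBoth? : Decidable (λ C → Emb A C × Emb B C)
  containsBoth? = emb? A ∩? emb? B

  containsBoth-split : ∀ P → (∀ {C} → Emb P C → Emb A C × Emb B C) → ∀ n →
                       classCount P (true , true , false) n + count (emb? P) (enum n) ≡ count containsBoth? (enum n)
  containsBoth-split P inAB n = trans (ℕₚ.+-comm (classCount P (true , true , false) n) (count (emb? P) (enum n)))
     (sym (trans (count-split containsBoth? (emb? P) (enum n))
     (cong₂ _+_ (count-cong (containsBoth? ∩? emb? P) (emb? P) (λ C (_ , p) → p) (λ C p → inAB p , p) (enum n))
                (count-cong (containsBoth? ∩? ∁? (emb? P)) (λ C → classOf P C ≟K (true , true , false))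
                   (λ C ((a , b) , np) → ,,-cong (containsᵇ-true⁺ A C a) (containsᵇ-true⁺ B C b) (containsᵇ-false⁺ P C np))
                   (λ C e → let (a , b , c) = ,,-injective e in (containsᵇ-true⁻ A C a , containsᵇ-true⁻ B C b) , containsᵇ-false⁻ P C c)
                   (enum n)))))

  classCounts≡ : ∀ c n → classCount (pair A B) c n ≡ classCount (pair B A) c n
  classCounts≡ (true , true , true) n =
    trans (containsPair-count _ AB⇒A,B n) (trans (pairContainCount≡ n) (sym (containsPair-count _ BA⇒A,B n)))
  classCounts≡ (true , true , false) n = ℕₚ.+-cancelʳ-≡ (count (emb? (pair A B)) (enum n)) _ _
    (trans (containsBoth-split _ AB⇒A,B n)
    (trans (sym (containsBoth-split _ BA⇒A,B n))
           (cong (classCount (pair B A) (true , true , false) n +_) (sym (pairContainCount≡ n)))))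
  classCounts≡ (true , false , true) = NotBoth.noPair-containsPair true false (λ _ ())
  classCounts≡ (true , false , false) = NotBoth.noPair-avoidsPair true false (λ _ ())
  classCounts≡ (false , y , true) = NotBoth.noPair-containsPair false y (λ ())
  classCounts≡ (false , y , false) = NotBoth.noPair-avoidsPair false y (λ ())

  classBijection : ClassBijection (classOf (pair A B)) (classOf (pair B A))
  classBijection = ClassBijectionFromCounts.classBijection _≟K_ (classOf (pair A B)) (classOf (pair B A)) classCounts≡

pair-swap : ∀ A B → (∀ n → avCount (pair A B) n ≡ avCount (pair B A) n) → WordSwap (pair A B) (pair B A)
pair-swap A B h = segmentSwap⇒wordSwap (ReverseSwap.swap A B S.f S.g S.gf S.fg S.fsize
  (λ C → containsᵇ-transfer A A (same-A C)) (λ C → containsᵇ-transfer A A (sym (same-A C)))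
  (λ C → containsᵇ-transfer B B (same-B C)) (λ C → containsᵇ-transfer B B (sym (same-B C)))
  (λ C → containsᵇ-transfer (pair A B) (pair B A) (pair-swapped C))
  (λ C → containsᵇ-transfer (pair B A) (pair A B) (sym (pair-swapped C))))
  where
  module S = ClassBijection (PairClasses.classBijection A B h)
  same-A : ∀ C → containsᵇ A (S.f C) ≡ containsᵇ A C
  same-A C = proj₁ (,,-injective (S.fclass C))
  same-B : ∀ C → containsᵇ B (S.f C) ≡ containsᵇ B C
  same-B C = proj₁ (proj₂ (,,-injective (S.fclass C)))
  pair-swapped : ∀ C → containsᵇ (pair B A) (S.f C) ≡ containsᵇ (pair A B) C
  pair-swapped C = proj₂ (proj₂ (,,-injective (S.fclass C)))

-- Wilf-equivalence of ∼-related arch systems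

context-swap : ∀ P Q {G G'} → WordSwap G G' → ⟦ P ++ G ++ Q ⟧A ≈ ⟦ P ++ G' ++ Q ⟧A
context-swap P Q W = WordSwapCount.gf≈ (PrefixContext.prefix-swap P (SuffixContext.suffix-swap Q W))

∼⇒gf≈ : ∀ {A B} → A ∼ B → ⟦ A ⟧A ≈ ⟦ B ⟧A
∼⇒gf≈ ∼-refl = ≈-refl
∼⇒gf≈ (∼-sym h) = ≈-sym (∼⇒gf≈ h)
∼⇒gf≈ (∼-trans h h') = ≈-trans (∼⇒gf≈ h) (∼⇒gf≈ h')
∼⇒gf≈ (R1 {A} {B} h) = gf-⟨⟩-cong A B (∼⇒gf≈ h)
∼⇒gf≈ (R2 P Q empty empty h) = ≈-refl
-- Nothing avoids ε, while ε avoids every atom: the two series already differ at size 0.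
∼⇒gf≈ (R2 P Q empty (atom C) h) with ∼⇒gf≈ h 0
... | ()
∼⇒gf≈ (R2 P Q (atom C) empty h) with ∼⇒gf≈ h 0
... | ()
∼⇒gf≈ (R2 P Q (atom A) (atom B) h) =
  context-swap P Q (atom-swap A B (gf≈⇒avCount≡ A B (gf-⟨⟩-injective A B (∼⇒gf≈ h))))
∼⇒gf≈ (R3 P Q empty b) = ≈-refl
∼⇒gf≈ (R3 P Q (atom A) empty) = ≈-refl
∼⇒gf≈ (R3 P Q (atom A) (atom B)) =
  context-swap P Q (pair-swap A B (gf≈⇒avCount≡ (pair A B) (pair B A) (gf-swap ⟨ A ⟩ ⟨ B ⟩ (atom A) (atom B))))
∼⇒gf≈ (R4 a b c) = gf-R4 _ _ _ a b c

AvOfSize-≡ : ∀ {A n} {x y : AvOfSize A n} → AvOfSize.sys x ≡ AvOfSize.sys y → x ≡ y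
AvOfSize-≡ {x = av C _ _} {av .C _ _} refl = refl

avoiders↔ : ∀ A B → (∀ n → avCount A n ≡ avCount B n) → ∀ n → AvOfSize A n ↔ AvOfSize B n
avoiders↔ A B h n = mk↔ₛ′ to from (λ { (av C _ _) → AvOfSize-≡ (T.fg C) }) (λ { (av C _ _) → AvOfSize-≡ (T.gf C) })
  where
  module T = ClassBijection (containment-bijection A B h)
  to : AvOfSize A n → AvOfSize B n
  to (av C p q) = av (T.f C) (trans (T.fsize C) p) (λ s → q (Emb⇒⊑ (containsᵇ-transfer B A (sym (T.fclass C)) (⊑⇒Emb s))))
  from : AvOfSize B n → AvOfSize A n
  from (av C p q) = av (T.g C) (trans (T.gsize C) p) (λ s → q (Emb⇒⊑ (containsᵇ-transfer A B (sym (T.gclass C)) (⊑⇒Emb s))))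

mainTheorem1 : ∀ (A B : Arch) → A ∼ B → ∀ (n : ℕ) → AvOfSize A n ↔ AvOfSize B n
mainTheorem1 A B h = avoiders↔ A B (gf≈⇒avCount≡ A B (∼⇒gf≈ h))
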